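{- Let $w$ be a prefix normal word and let $3\le i\le |w|+3$. Then (i) $L_{\mathrm{RC}(w)}(i)=\ell(\mathrm{Left}_i(\mathrm{RC}(w)))$; and (ii) $\Delta L_{\mathrm{RC}(w)}=w$.
   Context: A binary word $u$ over $\{0,1\}$ is prefix normal if for every prefix $p$ and every factor $f$ of $u$ with $|p|=|f|$, $|p|_1\ge|f|_1$, where $|x|_1$ is the number of $1$'s in $x$. A caterpillar sequence is a finite sequence $S=(s_1,\dots,s_k)$ of non-negative integers with $s_1,s_k\ge1$, and $s_1\ge2$ if $k=1$; its size is $|S|=k+\sum_j s_j$ and its number of leaves is $\ell(S)=\sum_j s_j$. Its associated caterpillar graph is a path $v_1,\dots,v_k$ with $s_j$ pendant leaves attached to $v_j$; $L_S$ is the leaf function of this graph, where for a simple graph $G$ with $n$ vertices $L_G(i)$ ($0\le i\le n$) is the maximum number of degree-1 vertices of an induced subtree of $G$ with $i$ vertices ($-\infty$ if none). The leaf word $\Delta L_G$ of $G$ is the word of length $n-3$ whose $i$-th letter is $L_G(i+3)-L_G(i+2)$ (or the symbol $\omega$ if one of these values is $-\infty$); $\Delta L_S$ denotes the leaf word of the caterpillar graph of $S$. The reading caterpillar sequence is defined by $\mathrm{RC}(\varepsilon)=(2)$ and, if $\mathrm{RC}(u)=(r_1,\dots,r_k)$, $\mathrm{RC}(u0)=(r_1,\dots,r_k-1,1)$, $\mathrm{RC}(u1)=(r_1,\dots,r_k+1)$. For a caterpillar sequence $S=(s_1,\dots,s_k)$ and $3\le i\le|S|$, $\mathrm{Left}_i(S)$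 is defined recursively: $\mathrm{Left}_i(S)=S$ if $i=|S|$; $\mathrm{Left}_i(S)=\mathrm{Left}_i(s_1,\dots,s_{k-1},s_k-1)$ if $i<|S|$ and $s_k\ge2$; $\mathrm{Left}_i(S)=\mathrm{Left}_i(s_1,\dots,s_{k-2},s_{k-1}+1)$ if $i<|S|$ and $s_k=1$. -}

module Defs where

open import Data.Bool using (Bool; true; false; _∧_; _∨_; T)
open import Data.Nat using (ℕ; zero; suc; _+_; _∸_; _≤_; _≡ᵇ_)
open import Data.Integer using (ℤ; +_; _⊖_)
open import Data.List using (List; []; _∷_; length; foldl; reverse; map; upTo; concat; zipWith; replicate; _++_; take; drop)
import Data.List as L
open import Data.Nat.ListAction using (sum)
open import Data.Unit using (⊤)
open import Data.Empty using (⊥)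
open import Data.Fin using (Fin; toℕ)
open import Data.Vec using (Vec; tabulate; lookup)
open import Data.Fin.Subset using (Subset; ∣_∣)
open import Data.Product using (Σ; ∃; _×_)
open import Data.List.Relation.Unary.All using (All)
open import Data.List.Relation.Unary.Unique.Propositional using (Unique)
open import Relation.Binary.PropositionalEquality using (_≡_)
open import Relation.Binary.Construct.Closure.ReflexiveTransitive using (Star)
open import Relation.Nullary using (¬_)

-- Binary words (letter 0 = false, letter 1 = true)

Word : Set
Word = List Bool

bit : Bool → ℕ
bit true  = 1
bit false = 0

ones : Word → ℕ
ones u = sum (map bit u)

PrefixNormal : Word → Set
PrefixNormal u = ∀ (j m : ℕ) → j + m ≤ length u →
  ones (take m (drop j u)) ≤ ones (take m u)

size : List ℕ → ℕ
size S = length S + sum S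

leafCount : List ℕ → ℕ
leafCount S = sum S

-- reading caterpillar sequence; work on the reversed list (last entry first)
rcStep : List ℕ → Bool → List ℕ
rcStep []       _     = []            -- never reached
rcStep (r ∷ rs) false = 1 ∷ (r ∸ 1) ∷ rs
rcStep (r ∷ rs) true  = suc r ∷ rs

RC : Word → List ℕ
RC u = reverse (foldl rcStep (2 ∷ []) u)

leftStepRev : List ℕ → List ℕ
leftStepRev (suc (suc t) ∷ rs) = suc t ∷ rs
leftStepRev (1 ∷ p ∷ rs)       = suc p ∷ rs
leftStepRev rs                 = rs                  -- not reached for valid data

iterate : ℕ → (List ℕ → List ℕ) → List ℕ → List ℕ
iterate zero    f x = x
iterate (suc n) f x = iterate n f (f x)

-- Left_i(S): each step decreases the size by exactly one, so exactly
-- |S| - i steps are performed until the size equals i.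
Left : ℕ → List ℕ → List ℕ
Left i S = reverse (iterate (size S ∸ i) leftStepRev (reverse S))

lastOr : ∀ {A : Set} → A → List A → A
lastOr x []       = x
lastOr x (y ∷ ys) = lastOr y ys

record Graph : Set where
  field
    n   : ℕ
    adj : Fin n → Fin n → Bool

open Graph public

module _ (G : Graph) where

  Adj : Fin (n G) → Fin (n G) → Set
  Adj u v = T (adj G u v)

  _∈ₛ_ : Fin (n G) → Subset (n G) → Set
  v ∈ₛ S = T (lookup S v)

  AdjIn : Subset (n G) → Fin (n G) → Fin (n G) → Set
  AdjIn S u v = (u ∈ₛ S) × (v ∈ₛ S) × Adj u v

  Connected : Subset (n G) → Set
  Connected S = ∀ u v → u ∈ₛ S → v ∈ₛ S → Star (AdjIn S) u v

  ChainIn : Subset (n G) → Fin (n G) → List (Fin (n G)) → Set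
  ChainIn S x []       = ⊤
  ChainIn S x (y ∷ ys) = AdjIn S x y × ChainIn S y ys

  IsCycle : Subset (n G) → List (Fin (n G)) → Set
  IsCycle S []       = ⊥
  IsCycle S (x ∷ xs) =
    3 ≤ length (x ∷ xs) × Unique (x ∷ xs) × ChainIn S x xs ×
    AdjIn S (lastOr x xs) x

  Acyclic : Subset (n G) → Set
  Acyclic S = ¬ (Σ (List (Fin (n G))) (IsCycle S))

  InducedTree : Subset (n G) → Set
  InducedTree S = (Σ (Fin (n G)) (λ v → v ∈ₛ S)) × Connected S × Acyclic S

  degIn : Subset (n G) → Fin (n G) → ℕ
  degIn S v = ∣ tabulate (λ u → lookup S u ∧ adj G u v) ∣

  leavesIn : Subset (n G) → ℕ
  leavesIn S = ∣ tabulate (λ v → lookup S v ∧ (degIn S v ≡ᵇ 1)) ∣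

data ℕ₋∞ : Set where
  -∞  : ℕ₋∞
  fin : ℕ → ℕ₋∞

-- LeafValue G i v  expresses  L_G(i) = v
LeafValue : (G : Graph) → ℕ → ℕ₋∞ → Set
LeafValue G i -∞      =
  ¬ (Σ (Subset (n G)) λ S → (∣ S ∣ ≡ i) × InducedTree G S)
LeafValue G i (fin m) =
  (Σ (Subset (n G)) λ S → (∣ S ∣ ≡ i) × InducedTree G S × (leavesIn G S ≡ m)) ×
  (∀ S → ∣ S ∣ ≡ i → InducedTree G S → leavesIn G S ≤ m)

-- ΔL_G = w : w has length n - 3 and its j-th letter (0-indexed) equals
-- L_G(j+4) - L_G(j+3), both values being finite (no letter ω).
LeafWordIs : Graph → Word → Set
LeafWordIs G w =
  (length w + 3 ≡ n G) ×
  (∀ (j : Fin (length w)) → Σ ℕ λ a → Σ ℕ λ b →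
     LeafValue G (toℕ j + 3) (fin a) × LeafValue G (toℕ j + 4) (fin b) ×
     (b ⊖ a ≡ + bit (L.lookup w j)))

data Label : Set where
  spine : ℕ → Label     -- spine vertex v_{j+1}
  leaf  : ℕ → Label     -- pendant leaf attached to v_{j+1}

labels : List ℕ → List Label
labels S = map spine (upTo (length S)) ++
           concat (zipWith (λ j s → replicate s (leaf j)) (upTo (length S)) S)

labelAdj : Label → Label → Bool
labelAdj (spine a) (spine b) = (suc a ≡ᵇ b) ∨ (suc b ≡ᵇ a)
labelAdj (spine a) (leaf b)  = a ≡ᵇ b
labelAdj (leaf a)  (spine b) = a ≡ᵇ b
labelAdj (leaf a)  (leaf b)  = false

caterpillar : List ℕ → Graph
caterpillar S = record
  { n   = length (labels S)
  ; adj = λ u v → labelAdj (L.lookup (labels S) u) (L.lookup (labels S) v)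
  }

module Submission where

open import Defs
open import Data.Nat using (ℕ; _≤_; _+_)
open import Data.List using (length)
open import Data.Product using (_×_)

open import Data.Bool using (Bool; true; false; _∧_; T; if_then_else_; not)
open import Data.Bool.Properties using (T-≡)
open import Function using (_∘_; Equivalence)
open import Data.Nat as N using (zero; suc; _∸_; _*_; _<_; z≤n; s≤s; _≡ᵇ_; _⊓_; ⌊_/2⌋)
open import Data.Nat.Properties
open import Data.List as L using (List; []; _∷_; _++_; map; take; drop; replicate; reverse; foldl; concat; zipWith; upTo; applyUpTo; [_]; _∷ʳ_)
import Data.List.Properties as LP
open import Data.Nat.ListAction using (sum)
open import Data.Product using (Σ; _,_; proj₁; proj₂)
open import Data.Sum using (_⊎_; inj₁; inj₂)
open import Data.Empty using (⊥; ⊥-elim)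
open import Data.Unit using (⊤; tt)
open import Data.Fin as F using (Fin; toℕ)
open import Data.Vec as V using (Vec; tabulate; lookup)
import Data.Vec.Properties as VP
open import Data.Fin.Subset using (Subset; ∣_∣)
open import Relation.Binary.PropositionalEquality hiding ([_])
open import Relation.Nullary
open import Relation.Binary.Definitions using (tri<; tri≈; tri>)
open import Relation.Binary.Construct.Closure.ReflexiveTransitive using (Star; ε; _◅_; _◅◅_)
import Relation.Binary.Construct.Closure.ReflexiveTransitive as Star
open import Data.Nat.Tactic.RingSolver
open import Data.List.Relation.Unary.All as All using (All; []; _∷_)
import Data.List.Relation.Unary.All.Properties as AllP
open import Data.List.Relation.Unary.Unique.Propositional using (Unique)
open import Data.List.Relation.Unary.AllPairs.Core using ([]; _∷_)
open import Data.Integer as Z using (_⊖_)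
import Data.Integer.Properties as ZP
import Data.Fin.Properties as FP
import Algebra.Properties.CommutativeSemigroup +-commutativeSemigroup as +-CS

-- Encode a caterpillar sequence S as the word 0 1^{s₁} ⋯ 0 1^{s_k}; the encoding of RC(w) is
-- 0 1 w 1, and Left_{3+j} undoes the reading of the last |w| − j letters, so that
-- ℓ(Left_{3+j}(RC w)) = 2 + |w[..j]|₁.
-- An induced subgraph is determined up to isomorphism by the spine vertices it contains and the
-- number of pendant leaves it keeps at each of them. For a tree with i vertices, dropping an absent
-- first spine vertex, re-reading a first spine vertex that is a leaf as a pendant leaf of its
-- neighbour, and contracting the first two spine vertices (which deletes a 0 from the word) show that
-- it has at most 2 + |f|₁ leaves for a factor f of w of length i − 3; prefix normality bounds this by
-- 2 + |w[..i−3]|₁. The subtree spanned by the prefix of length i of the encoding attains the bound,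
-- since induced subgraphs of a caterpillar are acyclic. Part (ii) is the difference of consecutive values.

block : ℕ → Word
block t = false ∷ replicate t true

encode : List ℕ → Word
encode s = concat (map block s)

-- For RC w this is w 1.
innerWord : List ℕ → Word
innerWord s = drop 2 (encode s)

ones-++ : ∀ u v → ones (u ++ v) ≡ ones u + ones v
ones-++ []      v = refl
ones-++ (b ∷ u) v = trans (cong (bit b +_) (ones-++ u v)) (sym (+-assoc (bit b) (ones u) (ones v)))

ones-replicate-true : ∀ t → ones (replicate t true) ≡ t
ones-replicate-true zero    = refl
ones-replicate-true (suc t) = cong suc (ones-replicate-true t)

replicate-suc-∷ʳ : ∀ {A : Set} r (x : A) → replicate (suc r) x ≡ replicate r x ∷ʳ x
replicate-suc-∷ʳ zero    x = refl
replicate-suc-∷ʳ (suc r) x = cong (x ∷_) (replicate-suc-∷ʳ r x)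

replicate-+ : ∀ {A : Set} a b (x : A) → replicate (a + b) x ≡ replicate a x ++ replicate b x
replicate-+ zero    b x = refl
replicate-+ (suc a) b x = cong (x ∷_) (replicate-+ a b x)

encode-++ : ∀ a b → encode (a ++ b) ≡ encode a ++ encode b
encode-++ []      b = refl
encode-++ (t ∷ a) b = trans (cong (block t ++_) (encode-++ a b)) (sym (LP.++-assoc (block t) (encode a) (encode b)))

ones-encode : ∀ s → ones (encode s) ≡ sum s
ones-encode []      = refl
ones-encode (t ∷ s) = trans (ones-++ (block t) (encode s)) (cong₂ _+_ (ones-replicate-true t) (ones-encode s))

length-encode-∷ : ∀ t s → length (encode (t ∷ s)) ≡ suc (t + length (encode s))
length-encode-∷ t s = cong suc (trans (LP.length-++ (replicate t true)) (cong (_+ length (encode s)) (LP.length-replicate t)))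

length-encode : ∀ s → length (encode s) ≡ size s
length-encode []      = refl
length-encode (t ∷ s) = begin
  length (encode (t ∷ s))      ≡⟨ length-encode-∷ t s ⟩
  suc (t + length (encode s))  ≡⟨ cong (λ n → suc (t + n)) (length-encode s) ⟩
  suc (t + (length s + sum s)) ≡⟨ cong suc (+-CS.x∙yz≈y∙xz t (length s) (sum s)) ⟩
  suc (length s + (t + sum s)) ∎
  where open ≡-Reasoning

encode-reverse-∷ : ∀ r rs → encode (reverse (r ∷ rs)) ≡ encode (reverse rs) ++ block r
encode-reverse-∷ r rs = begin
  encode (reverse (r ∷ rs))          ≡⟨ cong encode (LP.unfold-reverse r rs) ⟩
  encode (reverse rs ++ [ r ])       ≡⟨ encode-++ (reverse rs) [ r ] ⟩
  encode (reverse rs) ++ block r ++ [] ≡⟨ cong (encode (reverse rs) ++_) (LP.++-identityʳ (block r)) ⟩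
  encode (reverse rs) ++ block r     ∎
  where open ≡-Reasoning

rcRev : Word → List ℕ
rcRev w = foldl rcStep (2 ∷ []) w

HeadPositive : List ℕ → Set
HeadPositive []      = ⊥
HeadPositive (r ∷ _) = 1 ≤ r

rcStep-headPositive : ∀ acc b → HeadPositive acc → HeadPositive (rcStep acc b)
rcStep-headPositive (r ∷ rs) false _ = s≤s z≤n
rcStep-headPositive (r ∷ rs) true  _ = s≤s z≤n

foldl-rcStep-headPositive : ∀ u acc → HeadPositive acc → HeadPositive (foldl rcStep acc u)
foldl-rcStep-headPositive []      acc h = h
foldl-rcStep-headPositive (b ∷ u) acc h = foldl-rcStep-headPositive u (rcStep acc b) (rcStep-headPositive acc b h)

leftStepRev-rcStep : ∀ acc b → HeadPositive acc → leftStepRev (rcStep acc b) ≡ acc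
leftStepRev-rcStep (suc r ∷ rs) false _ = refl
leftStepRev-rcStep (suc r ∷ rs) true  _ = refl

encode-reverse-suc : ∀ r rs → encode (reverse (suc r ∷ rs)) ≡ encode (reverse (r ∷ rs)) ∷ʳ true
encode-reverse-suc r rs = begin
  encode (reverse (suc r ∷ rs))             ≡⟨ encode-reverse-∷ (suc r) rs ⟩
  encode (reverse rs) ++ block (suc r)      ≡⟨ cong (λ z → encode (reverse rs) ++ false ∷ z) (replicate-suc-∷ʳ r true) ⟩
  encode (reverse rs) ++ block r ∷ʳ true    ≡⟨ LP.++-assoc (encode (reverse rs)) (block r) [ true ] ⟨
  (encode (reverse rs) ++ block r) ∷ʳ true  ≡⟨ cong (_∷ʳ true) (encode-reverse-∷ r rs) ⟨
  encode (reverse (r ∷ rs)) ∷ʳ true         ∎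
  where open ≡-Reasoning

encode-rcStep : ∀ acc b P → HeadPositive acc → encode (reverse acc) ≡ P ∷ʳ true →
                encode (reverse (rcStep acc b)) ≡ (P ∷ʳ b) ∷ʳ true
encode-rcStep (suc r ∷ rs) true  P _ eq = trans (encode-reverse-suc (suc r) rs) (cong (_∷ʳ true) eq)
encode-rcStep (suc r ∷ rs) false P _ eq = begin
  encode (reverse (1 ∷ r ∷ rs))                 ≡⟨ encode-reverse-∷ 1 (r ∷ rs) ⟩
  encode (reverse (r ∷ rs)) ++ false ∷ true ∷ [] ≡⟨ cong (_++ false ∷ true ∷ []) lastBlockShortened ⟩
  P ++ false ∷ true ∷ []                        ≡⟨ LP.++-assoc P [ false ] [ true ] ⟨
  (P ∷ʳ false) ∷ʳ true                          ∎
  where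
  open ≡-Reasoning
  lastBlockShortened : encode (reverse (r ∷ rs)) ≡ P
  lastBlockShortened = LP.∷ʳ-injectiveˡ _ _ (trans (sym (encode-reverse-suc r rs)) eq)

encode-foldl-rcStep : ∀ u acc P → HeadPositive acc → encode (reverse acc) ≡ P ∷ʳ true →
                      encode (reverse (foldl rcStep acc u)) ≡ P ++ u ∷ʳ true
encode-foldl-rcStep []      acc P h eq = eq
encode-foldl-rcStep (b ∷ u) acc P h eq =
  trans (encode-foldl-rcStep u (rcStep acc b) (P ∷ʳ b) (rcStep-headPositive acc b h) (encode-rcStep acc b P h eq))
        (LP.++-assoc P [ b ] (u ∷ʳ true))

encode-RC : ∀ w → encode (RC w) ≡ false ∷ true ∷ w ∷ʳ true
encode-RC w = encode-foldl-rcStep w (2 ∷ []) (false ∷ true ∷ []) (s≤s z≤n) refl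

innerWord-RC : ∀ w → innerWord (RC w) ≡ w ∷ʳ true
innerWord-RC w = cong (drop 2) (encode-RC w)

length-encode-RC : ∀ w → length (encode (RC w)) ≡ length w + 3
length-encode-RC w = begin
  length (encode (RC w))          ≡⟨ cong length (encode-RC w) ⟩
  suc (suc (length (w ∷ʳ true)))  ≡⟨ cong (λ n → suc (suc n)) (LP.length-++ w) ⟩
  suc (suc (length w + 1))        ≡⟨ cong (λ n → suc (suc n)) (+-comm (length w) 1) ⟩
  3 + length w                    ≡⟨ +-comm 3 (length w) ⟩
  length w + 3                    ∎
  where open ≡-Reasoning

size-RC : ∀ w → size (RC w) ≡ length w + 3
size-RC w = trans (sym (length-encode (RC w))) (length-encode-RC w)

headPositive-RC : ∀ w → HeadPositive (RC w)
headPositive-RC w = go (RC w) (encode-RC w)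
  where
  go : ∀ s → encode s ≡ false ∷ true ∷ w ∷ʳ true → HeadPositive s
  go (suc t ∷ s) _ = s≤s z≤n
  go (zero ∷ []) ()
  go (zero ∷ _ ∷ _) ()

leafCount-RC : ∀ w → leafCount (RC w) ≡ 2 + ones w
leafCount-RC w = begin
  sum (RC w)                 ≡⟨ ones-encode (RC w) ⟨
  ones (encode (RC w))       ≡⟨ cong ones (encode-RC w) ⟩
  suc (ones (w ∷ʳ true))     ≡⟨ cong suc (ones-++ w [ true ]) ⟩
  suc (ones w + 1)           ≡⟨ cong suc (+-comm (ones w) 1) ⟩
  2 + ones w                 ∎
  where open ≡-Reasoning

iterate-leftStepRev-rcRev : ∀ r u → iterate (length r) leftStepRev (rcRev (u ++ reverse r)) ≡ rcRev u
iterate-leftStepRev-rcRev []      u = cong rcRev (LP.++-identityʳ u)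
iterate-leftStepRev-rcRev (b ∷ r) u = begin
  iterate (suc (length r)) leftStepRev (rcRev (u ++ reverse (b ∷ r)))
    ≡⟨ cong (λ z → iterate (suc (length r)) leftStepRev (rcRev (u ++ z))) (LP.unfold-reverse b r) ⟩
  iterate (suc (length r)) leftStepRev (rcRev (u ++ (reverse r ∷ʳ b)))
    ≡⟨ cong (λ z → iterate (suc (length r)) leftStepRev (rcRev z)) (LP.++-assoc u (reverse r) [ b ]) ⟨
  iterate (length r) leftStepRev (leftStepRev (rcRev ((u ++ reverse r) ∷ʳ b)))
    ≡⟨ cong (λ z → iterate (length r) leftStepRev (leftStepRev z)) (LP.foldl-∷ʳ rcStep (2 ∷ []) b (u ++ reverse r)) ⟩
  iterate (length r) leftStepRev (leftStepRev (rcStep (rcRev (u ++ reverse r)) b))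
    ≡⟨ cong (iterate (length r) leftStepRev)
            (leftStepRev-rcStep _ b (foldl-rcStep-headPositive (u ++ reverse r) (2 ∷ []) (s≤s z≤n))) ⟩
  iterate (length r) leftStepRev (rcRev (u ++ reverse r))
    ≡⟨ iterate-leftStepRev-rcRev r u ⟩
  rcRev u ∎
  where open ≡-Reasoning

-- Each step of Left undoes the reading of one letter.
Left-RC : ∀ w j → Left (3 + j) (RC w) ≡ RC (take j w)
Left-RC w j = begin
  reverse (iterate (size (RC w) ∸ (3 + j)) leftStepRev (reverse (reverse (rcRev w))))
    ≡⟨ cong₂ (λ n z → reverse (iterate n leftStepRev z)) steps (LP.reverse-involutive (rcRev w)) ⟩
  reverse (iterate (length r) leftStepRev (rcRev w))
    ≡⟨ cong (λ z → reverse (iterate (length r) leftStepRev (rcRev z))) split ⟩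
  reverse (iterate (length r) leftStepRev (rcRev (take j w ++ reverse r)))
    ≡⟨ cong reverse (iterate-leftStepRev-rcRev r (take j w)) ⟩
  RC (take j w) ∎
  where
  open ≡-Reasoning
  r = reverse (drop j w)
  steps : size (RC w) ∸ (3 + j) ≡ length r
  steps = begin
    size (RC w) ∸ (3 + j) ≡⟨ cong (_∸ (3 + j)) (trans (size-RC w) (+-comm (length w) 3)) ⟩
    length w ∸ j          ≡⟨ LP.length-drop j w ⟨
    length (drop j w)     ≡⟨ LP.length-reverse (drop j w) ⟨
    length r              ∎
  split : w ≡ take j w ++ reverse r
  split = trans (sym (LP.take++drop≡id j w)) (cong (take j w ++_) (sym (LP.reverse-involutive (drop j w))))

leafCount-Left-RC : ∀ w j → leafCount (Left (3 + j) (RC w)) ≡ 2 + ones (take j w)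
leafCount-Left-RC w j = trans (cong leafCount (Left-RC w j)) (leafCount-RC (take j w))

sumUpTo : ℕ → (ℕ → ℕ) → ℕ
sumUpTo zero    f = 0
sumUpTo (suc k) f = f 0 + sumUpTo k (λ j → f (suc j))

sumUpTo-cong : ∀ k {f g : ℕ → ℕ} → (∀ j → f j ≡ g j) → sumUpTo k f ≡ sumUpTo k g
sumUpTo-cong zero    e = refl
sumUpTo-cong (suc k) e = cong₂ _+_ (e 0) (sumUpTo-cong k (λ j → e (suc j)))

sumUpTo-+ : ∀ k (f g : ℕ → ℕ) → sumUpTo k (λ j → f j + g j) ≡ sumUpTo k f + sumUpTo k g
sumUpTo-+ zero    f g = refl
sumUpTo-+ (suc k) f g = trans (cong ((f 0 + g 0) +_) (sumUpTo-+ k _ _))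
                              (+-CS.interchange (f 0) (g 0) (sumUpTo k (λ j → f (suc j))) (sumUpTo k (λ j → g (suc j))))

sumUpTo-zero : ∀ k {f : ℕ → ℕ} → (∀ j → f j ≡ 0) → sumUpTo k f ≡ 0
sumUpTo-zero zero    e = refl
sumUpTo-zero (suc k) e = cong₂ _+_ (e 0) (sumUpTo-zero k (λ j → e (suc j)))

sumUpTo-single : ∀ k a {f : ℕ → ℕ} → (∀ j → j ≢ a → f j ≡ 0) → a < k → sumUpTo k f ≡ f a
sumUpTo-single (suc k) zero    {f} e _ =
  trans (cong (f 0 +_) (sumUpTo-zero k (λ j → e (suc j) (λ ())))) (+-identityʳ _)
sumUpTo-single (suc k) (suc a) {f} e (s≤s a<k) =
  trans (cong (_+ sumUpTo k (λ j → f (suc j))) (e 0 (λ ())))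
        (sumUpTo-single k a (λ j j≢a → e (suc j) (j≢a ∘ suc-injective)) a<k)

sumUpTo-beyond : ∀ k a {f : ℕ → ℕ} → (∀ j → j ≢ a → f j ≡ 0) → k ≤ a → sumUpTo k f ≡ 0
sumUpTo-beyond zero    a       e _ = refl
sumUpTo-beyond (suc k) (suc a) e (s≤s k≤a) =
  cong₂ _+_ (e 0 (λ ())) (sumUpTo-beyond k a (λ j j≢a → e (suc j) (j≢a ∘ suc-injective)) k≤a)

position : Label → ℕ
position (spine a) = a
position (leaf a)  = a

sameLabel : Label → Label → Bool
sameLabel (spine a) (spine b) = a ≡ᵇ b
sameLabel (leaf a)  (leaf b)  = a ≡ᵇ b
sameLabel (spine a) (leaf b)  = false
sameLabel (leaf a)  (spine b) = false

T⇒≡true : ∀ {b} → T b → b ≡ true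
T⇒≡true = Equivalence.to T-≡

≡true⇒T : ∀ {b} → b ≡ true → T b
≡true⇒T = Equivalence.from T-≡

sameLabel-refl : ∀ a → sameLabel a a ≡ true
sameLabel-refl (spine a) = T⇒≡true (≡⇒≡ᵇ a a refl)
sameLabel-refl (leaf a)  = T⇒≡true (≡⇒≡ᵇ a a refl)

sameLabel⇒≡ : ∀ a b → sameLabel a b ≡ true → a ≡ b
sameLabel⇒≡ (spine a) (spine b) e = cong spine (≡ᵇ⇒≡ a b (≡true⇒T e))
sameLabel⇒≡ (leaf a)  (leaf b)  e = cong leaf (≡ᵇ⇒≡ a b (≡true⇒T e))

≢⇒¬sameLabel : ∀ a b → a ≢ b → sameLabel a b ≡ false
≢⇒¬sameLabel a b a≢b with sameLabel a b in e
... | true  = ⊥-elim (a≢b (sameLabel⇒≡ a b e))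
... | false = refl

sumOver : (Label → ℕ) → List Label → ℕ
sumOver g []      = 0
sumOver g (a ∷ M) = g a + sumOver g M

count : Label → List Label → ℕ
count x M = sumOver (λ a → bit (sameLabel x a)) M

sumOver-++ : ∀ g A B → sumOver g (A ++ B) ≡ sumOver g A + sumOver g B
sumOver-++ g []      B = refl
sumOver-++ g (a ∷ A) B = trans (cong (g a +_) (sumOver-++ g A B)) (sym (+-assoc (g a) _ _))

sumOver-+ : ∀ M (g h : Label → ℕ) → sumOver (λ a → g a + h a) M ≡ sumOver g M + sumOver h M
sumOver-+ []      g h = refl
sumOver-+ (a ∷ M) g h = trans (cong ((g a + h a) +_) (sumOver-+ M g h))
                              (+-CS.interchange (g a) (h a) (sumOver g M) (sumOver h M))

count-here : ∀ a M → 1 ≤ count a (a ∷ M)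
count-here a M rewrite sameLabel-refl a = s≤s z≤n

count-there : ∀ ℓ a M → 1 ≤ count ℓ M → 1 ≤ count ℓ (a ∷ M)
count-there ℓ a M c = ≤-trans c (m≤n+m _ _)

count-∷ : ∀ ℓ a M → 1 ≤ count ℓ (a ∷ M) → (ℓ ≡ a) ⊎ (1 ≤ count ℓ M)
count-∷ ℓ a M c with sameLabel ℓ a in e
... | true  = inj₁ (sameLabel⇒≡ ℓ a e)
... | false = inj₂ c

sumOver-cong : ∀ M {g h} → (∀ ℓ → 1 ≤ count ℓ M → g ℓ ≡ h ℓ) → sumOver g M ≡ sumOver h M
sumOver-cong []      e = refl
sumOver-cong (a ∷ M) e = cong₂ _+_ (e a (count-here a M)) (sumOver-cong M (λ ℓ c → e ℓ (count-there ℓ a M c)))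

sumOver-zero : ∀ M {g} → (∀ ℓ → 1 ≤ count ℓ M → g ℓ ≡ 0) → sumOver g M ≡ 0
sumOver-zero []      e = refl
sumOver-zero (a ∷ M) e = cong₂ _+_ (e a (count-here a M)) (sumOver-zero M (λ ℓ c → e ℓ (count-there ℓ a M c)))

sumOver-byPosition : ∀ k M (g : Label → ℕ) → (∀ ℓ → 1 ≤ count ℓ M → position ℓ < k) →
  sumOver g M ≡ sumUpTo k (λ j → count (spine j) M * g (spine j) + count (leaf j) M * g (leaf j))
sumOver-byPosition k []      g h = sym (sumUpTo-zero k (λ j → refl))
sumOver-byPosition k (a ∷ M) g h = begin
  g a + sumOver g M
    ≡⟨ cong₂ _+_ (sym (indicator a (h a (count-here a M))))
                 (sumOver-byPosition k M g (λ ℓ c → h ℓ (count-there ℓ a M c))) ⟩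
  sumUpTo k (λ j → δ (spine j) * g (spine j) + δ (leaf j) * g (leaf j))
    + sumUpTo k (λ j → count (spine j) M * g (spine j) + count (leaf j) M * g (leaf j))
    ≡⟨ sumUpTo-+ k _ _ ⟨
  sumUpTo k (λ j → (δ (spine j) * g (spine j) + δ (leaf j) * g (leaf j))
                 + (count (spine j) M * g (spine j) + count (leaf j) M * g (leaf j)))
    ≡⟨ sumUpTo-cong k (λ j → regroup (δ (spine j)) (count (spine j) M) (g (spine j))
                                     (δ (leaf j)) (count (leaf j) M) (g (leaf j))) ⟩
  sumUpTo k (λ j → count (spine j) (a ∷ M) * g (spine j) + count (leaf j) (a ∷ M) * g (leaf j)) ∎
  where
  open ≡-Reasoning
  δ : Label → ℕ
  δ ℓ = bit (sameLabel ℓ a)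
  regroup : ∀ x₁ x₂ y u₁ u₂ v → (x₁ * y + u₁ * v) + (x₂ * y + u₂ * v) ≡ (x₁ + x₂) * y + (u₁ + u₂) * v
  regroup = solve-∀
  indicator : ∀ a → position a < k → sumUpTo k (λ j → bit (sameLabel (spine j) a) * g (spine j)
                                                    + bit (sameLabel (leaf j) a) * g (leaf j)) ≡ g a
  indicator (spine b) b<k = trans (sumUpTo-single k b off b<k) on
    where
    off : ∀ j → j ≢ b → bit (sameLabel (spine j) (spine b)) * g (spine j) + 0 ≡ 0
    off j j≢b rewrite ≢⇒¬sameLabel (spine j) (spine b) (j≢b ∘ cong position) = refl
    on : bit (sameLabel (spine b) (spine b)) * g (spine b) + 0 ≡ g (spine b)
    on rewrite sameLabel-refl (spine b) = trans (+-identityʳ _) (+-identityʳ _)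
  indicator (leaf b) b<k = trans (sumUpTo-single k b off b<k) on
    where
    off : ∀ j → j ≢ b → 0 + bit (sameLabel (leaf j) (leaf b)) * g (leaf j) ≡ 0
    off j j≢b rewrite ≢⇒¬sameLabel (leaf j) (leaf b) (j≢b ∘ cong position) = refl
    on : 0 + bit (sameLabel (leaf b) (leaf b)) * g (leaf b) ≡ g (leaf b)
    on rewrite sameLabel-refl (leaf b) = +-identityʳ _

selected : (xs : List Label) → Vec Bool (length xs) → List Label
selected []       V.[]          = []
selected (a ∷ xs) (true V.∷ X)  = a ∷ selected xs X
selected (a ∷ xs) (false V.∷ X) = selected xs X

∣∣≡length-selected : ∀ xs X → ∣ X ∣ ≡ length (selected xs X)
∣∣≡length-selected []       V.[]          = refl
∣∣≡length-selected (a ∷ xs) (true V.∷ X)  = cong suc (∣∣≡length-selected xs X)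
∣∣≡length-selected (a ∷ xs) (false V.∷ X) = ∣∣≡length-selected xs X

∣∣-∷ : ∀ {n} b (Y : Vec Bool n) → ∣ b V.∷ Y ∣ ≡ bit b + ∣ Y ∣
∣∣-∷ true  Y = refl
∣∣-∷ false Y = refl

∣tabulate∣≡sumOver-selected : ∀ xs X (g : Label → Bool) →
  ∣ tabulate (λ v → lookup X v ∧ g (L.lookup xs v)) ∣ ≡ sumOver (λ a → bit (g a)) (selected xs X)
∣tabulate∣≡sumOver-selected []       V.[]          g = refl
∣tabulate∣≡sumOver-selected (a ∷ xs) (true V.∷ X)  g =
  trans (∣∣-∷ (g a) (tabulate (λ v → lookup X v ∧ g (L.lookup xs v))))
        (cong (bit (g a) +_) (∣tabulate∣≡sumOver-selected xs X g))
∣tabulate∣≡sumOver-selected (a ∷ xs) (false V.∷ X) g = ∣tabulate∣≡sumOver-selected xs X g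

count-selected-lookup : ∀ xs X v → T (lookup X v) → 1 ≤ count (L.lookup xs v) (selected xs X)
count-selected-lookup (a ∷ xs) (true V.∷ X)  F.zero    _ = count-here a (selected xs X)
count-selected-lookup (a ∷ xs) (true V.∷ X)  (F.suc v) t =
  count-there (L.lookup xs v) a (selected xs X) (count-selected-lookup xs X v t)
count-selected-lookup (a ∷ xs) (false V.∷ X) (F.suc v) t = count-selected-lookup xs X v t

VertexOf : (xs : List Label) → Vec Bool (length xs) → Label → Set
VertexOf xs X ℓ = Σ (Fin (length xs)) λ v → T (lookup X v) × (L.lookup xs v ≡ ℓ)

count-selected⇒vertex : ∀ xs X ℓ → 1 ≤ count ℓ (selected xs X) → VertexOf xs X ℓ
count-selected⇒vertex [] V.[] ℓ ()
count-selected⇒vertex (a ∷ xs) (true V.∷ X) ℓ c with count-∷ ℓ a (selected xs X) c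
... | inj₁ ℓ≡a = F.zero , tt , sym ℓ≡a
... | inj₂ c′ with count-selected⇒vertex xs X ℓ c′
...   | v , t , e = F.suc v , t , e
count-selected⇒vertex (a ∷ xs) (false V.∷ X) ℓ c with count-selected⇒vertex xs X ℓ c
... | v , t , e = F.suc v , t , e

sumOver-selected-≤ : ∀ xs X g → sumOver g (selected xs X) ≤ sumOver g xs
sumOver-selected-≤ []       V.[]          g = z≤n
sumOver-selected-≤ (a ∷ xs) (true V.∷ X)  g = +-monoʳ-≤ (g a) (sumOver-selected-≤ xs X g)
sumOver-selected-≤ (a ∷ xs) (false V.∷ X) g = ≤-trans (sumOver-selected-≤ xs X g) (m≤n+m _ _)

decrementAt : Label → (Label → ℕ) → (Label → ℕ)
decrementAt a d ℓ = if sameLabel ℓ a then N.pred (d ℓ) else d ℓ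

realize : (xs : List Label) → (Label → ℕ) → Vec Bool (length xs)
realize []       d = V.[]
realize (a ∷ xs) d = step (d a)
  where
  step : ℕ → Vec Bool (suc (length xs))
  step zero    = false V.∷ realize xs d
  step (suc _) = true V.∷ realize xs (decrementAt a d)

count-realize : ∀ xs d ℓ → count ℓ (selected xs (realize xs d)) ≡ d ℓ ⊓ count ℓ xs
count-realize []       d ℓ = sym (m≥n⇒m⊓n≡n z≤n)
count-realize (a ∷ xs) d ℓ with d a in da
... | zero with sameLabel ℓ a in e
...   | true rewrite sameLabel⇒≡ ℓ a e =
  trans (count-realize xs d a) (trans (cong (_⊓ count a xs) da) (cong (_⊓ suc (count a xs)) (sym da)))
...   | false = count-realize xs d ℓ
count-realize (a ∷ xs) d ℓ | suc m with sameLabel ℓ a in e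
...   | true rewrite sameLabel⇒≡ ℓ a e | da =
  cong suc (trans (count-realize xs (decrementAt a d) a)
                  (cong (_⊓ count a xs) (trans (cong (λ b → if b then N.pred (d a) else d a) (sameLabel-refl a))
                                               (cong N.pred da))))
...   | false = trans (count-realize xs (decrementAt a d) ℓ) (cong (_⊓ count ℓ xs) unchanged)
  where
  unchanged : decrementAt a d ℓ ≡ d ℓ
  unchanged rewrite e = refl

-- s_{j+1}, with junk value 0 beyond the end of s
entry : List ℕ → ℕ → ℕ
entry []      _       = 0
entry (t ∷ s) zero    = t
entry (t ∷ s) (suc q) = entry s q

entry-beyond : ∀ s j → length s ≤ j → entry s j ≡ 0
entry-beyond []      j       _         = refl
entry-beyond (t ∷ s) (suc j) (s≤s le) = entry-beyond s j le

count-replicate : ∀ x t ℓ → count x (replicate t ℓ) ≡ t * bit (sameLabel x ℓ)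
count-replicate x zero    ℓ = refl
count-replicate x (suc t) ℓ = cong (bit (sameLabel x ℓ) +_) (count-replicate x t ℓ)

count-spines : ∀ x h n → count x (map spine (applyUpTo h n)) ≡ sumUpTo n (λ q → bit (sameLabel x (spine (h q))))
count-spines x h zero    = refl
count-spines x h (suc n) = cong (bit (sameLabel x (spine (h 0))) +_) (count-spines x (λ q → h (suc q)) n)

leafLabels : (ℕ → ℕ) → List ℕ → List Label
leafLabels h s = concat (zipWith (λ j t → replicate t (leaf j)) (applyUpTo h (length s)) s)

count-leafLabels : ∀ x h s → count x (leafLabels h s) ≡ sumUpTo (length s) (λ q → entry s q * bit (sameLabel x (leaf (h q))))
count-leafLabels x h []      = refl
count-leafLabels x h (t ∷ s) = trans (sumOver-++ _ (replicate t (leaf (h 0))) _)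
  (cong₂ _+_ (count-replicate x t (leaf (h 0))) (count-leafLabels x (λ q → h (suc q)) s))

count-labels : ∀ x s → count x (labels s) ≡ sumUpTo (length s) (λ q → bit (sameLabel x (spine q)))
                                           + sumUpTo (length s) (λ q → entry s q * bit (sameLabel x (leaf q)))
count-labels x s = trans (sumOver-++ _ (map spine (upTo (length s))) _)
                         (cong₂ _+_ (count-spines x (λ q → q) (length s)) (count-leafLabels x (λ q → q) s))

spineAt≢ : ∀ j q → q ≢ j → bit (sameLabel (spine j) (spine q)) ≡ 0
spineAt≢ j q q≢j rewrite ≢⇒¬sameLabel (spine j) (spine q) (q≢j ∘ sym ∘ cong position) = refl

leafAt≢ : ∀ s j q → q ≢ j → entry s q * bit (sameLabel (leaf j) (leaf q)) ≡ 0
leafAt≢ s j q q≢j rewrite ≢⇒¬sameLabel (leaf j) (leaf q) (q≢j ∘ sym ∘ cong position) = *-zeroʳ (entry s q)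

count-spine-labels : ∀ s j → j < length s → count (spine j) (labels s) ≡ 1
count-spine-labels s j j<k = trans (count-labels (spine j) s)
  (cong₂ _+_ (trans (sumUpTo-single (length s) j (spineAt≢ j) j<k) (cong bit (T⇒≡true (≡⇒≡ᵇ j j refl))))
             (sumUpTo-zero (length s) (λ q → *-zeroʳ (entry s q))))

count-spine-labels-beyond : ∀ s j → length s ≤ j → count (spine j) (labels s) ≡ 0
count-spine-labels-beyond s j k≤j = trans (count-labels (spine j) s)
  (cong₂ _+_ (sumUpTo-beyond (length s) j (spineAt≢ j) k≤j) (sumUpTo-zero (length s) (λ q → *-zeroʳ (entry s q))))

count-spine-labels-≤1 : ∀ s j → count (spine j) (labels s) ≤ 1
count-spine-labels-≤1 s j with j N.<? length s
... | yes j<k = ≤-reflexive (count-spine-labels s j j<k)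
... | no j≮k  = ≤-trans (≤-reflexive (count-spine-labels-beyond s j (≮⇒≥ j≮k))) z≤n

count-leaf-labels : ∀ s j → count (leaf j) (labels s) ≡ entry s j
count-leaf-labels s j with j N.<? length s
... | yes j<k = trans (count-labels (leaf j) s)
  (trans (cong₂ _+_ (sumUpTo-zero (length s) (λ q → refl)) (sumUpTo-single (length s) j (leafAt≢ s j) j<k))
         (trans (cong (λ b → entry s j * bit b) (T⇒≡true (≡⇒≡ᵇ j j refl))) (*-identityʳ _)))
... | no j≮k = trans (count-labels (leaf j) s)
  (trans (cong₂ _+_ (sumUpTo-zero (length s) (λ q → refl)) (sumUpTo-beyond (length s) j (leafAt≢ s j) (≮⇒≥ j≮k)))
         (sym (entry-beyond s j (≮⇒≥ j≮k))))

position-labels : ∀ s ℓ → 1 ≤ count ℓ (labels s) → position ℓ < length s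
position-labels s ℓ c with position ℓ N.<? length s
... | yes ℓ<k = ℓ<k
... | no ℓ≮k = ⊥-elim (n≮0 (≤-trans c (≤-reflexive (absent ℓ (≮⇒≥ ℓ≮k)))))
  where
  absent : ∀ ℓ → length s ≤ position ℓ → count ℓ (labels s) ≡ 0
  absent (spine j) = count-spine-labels-beyond s j
  absent (leaf j) k≤j = trans (count-leaf-labels s j) (entry-beyond s j k≤j)

length-leafLabels : ∀ h s → length (leafLabels h s) ≡ sum s
length-leafLabels h []      = refl
length-leafLabels h (t ∷ s) = trans (LP.length-++ (replicate t (leaf (h 0))))
                                    (cong₂ _+_ (LP.length-replicate t) (length-leafLabels (λ q → h (suc q)) s))

length-labels : ∀ s → length (labels s) ≡ size s
length-labels s = trans (LP.length-++ (map spine (upTo (length s))))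
  (cong₂ _+_ (trans (LP.length-map spine (upTo (length s))) (LP.length-applyUpTo (λ q → q) (length s)))
             (length-leafLabels (λ q → q) s))

degree : List Label → Label → ℕ
degree M ℓ = sumOver (λ a → bit (labelAdj a ℓ)) M

leaves : List Label → ℕ
leaves M = sumOver (λ a → bit (degree M a ≡ᵇ 1)) M

≡ᵇ-sym : ∀ a b → (a ≡ᵇ b) ≡ (b ≡ᵇ a)
≡ᵇ-sym zero    zero    = refl
≡ᵇ-sym zero    (suc b) = refl
≡ᵇ-sym (suc a) zero    = refl
≡ᵇ-sym (suc a) (suc b) = ≡ᵇ-sym a b

2+n≡ᵇn : ∀ n → (suc (suc n) ≡ᵇ n) ≡ false
2+n≡ᵇn zero    = refl
2+n≡ᵇn (suc n) = 2+n≡ᵇn n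

bit-≡ᵇ1 : ∀ b → 2 ≤ b → bit (b ≡ᵇ 1) ≡ 0
bit-≡ᵇ1 (suc (suc b)) _ = refl
bit-≡ᵇ1 (suc zero) (s≤s ())

countBefore : List Label → ℕ → ℕ
countBefore M zero    = 0
countBefore M (suc j) = count (spine j) M

isSpineBefore : Label → ℕ → ℕ
isSpineBefore a zero    = 0
isSpineBefore a (suc j) = bit (sameLabel (spine j) a)

bit-labelAdj-spine : ∀ a j → bit (labelAdj a (spine j))
                           ≡ (isSpineBefore a j + bit (sameLabel (spine (suc j)) a)) + bit (sameLabel (leaf j) a)
bit-labelAdj-spine (spine a) zero = sym (+-identityʳ _)
bit-labelAdj-spine (spine a) (suc j) with a ≡ᵇ j in e
... | true rewrite ≡ᵇ⇒≡ a j (≡true⇒T e) | 2+n≡ᵇn j | T⇒≡true (≡⇒≡ᵇ j j refl) = refl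
... | false rewrite ≡ᵇ-sym j a | e = sym (+-identityʳ _)
bit-labelAdj-spine (leaf a) zero    = cong bit (≡ᵇ-sym a 0)
bit-labelAdj-spine (leaf a) (suc j) = cong bit (≡ᵇ-sym a (suc j))

bit-labelAdj-leaf : ∀ a j → bit (labelAdj a (leaf j)) ≡ bit (sameLabel (spine j) a)
bit-labelAdj-leaf (spine a) j = cong bit (≡ᵇ-sym a j)
bit-labelAdj-leaf (leaf a)  j = refl

degree-spine : ∀ M j → degree M (spine j) ≡ (countBefore M j + count (spine (suc j)) M) + count (leaf j) M
degree-spine M j = begin
  degree M (spine j)
    ≡⟨ sumOver-cong M (λ a _ → bit-labelAdj-spine a j) ⟩
  sumOver (λ a → (isSpineBefore a j + bit (sameLabel (spine (suc j)) a)) + bit (sameLabel (leaf j) a)) M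
    ≡⟨ sumOver-+ M _ _ ⟩
  sumOver (λ a → isSpineBefore a j + bit (sameLabel (spine (suc j)) a)) M + count (leaf j) M
    ≡⟨ cong (_+ count (leaf j) M) (sumOver-+ M _ _) ⟩
  (sumOver (λ a → isSpineBefore a j) M + count (spine (suc j)) M) + count (leaf j) M
    ≡⟨ cong (λ z → (z + count (spine (suc j)) M) + count (leaf j) M) (before j) ⟩
  (countBefore M j + count (spine (suc j)) M) + count (leaf j) M ∎
  where
  open ≡-Reasoning
  before : ∀ j → sumOver (λ a → isSpineBefore a j) M ≡ countBefore M j
  before zero    = sumOver-zero M (λ _ _ → refl)
  before (suc j) = refl

degree-leaf : ∀ M j → degree M (leaf j) ≡ count (spine j) M
degree-leaf M j = sumOver-cong M (λ a _ → bit-labelAdj-leaf a j)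

-- A subgraph is described by its profile: xs j ∈ {0,1} tells whether spine vertex j is
-- present and cs j how many of its pendant leaves are; pv is the presence of the spine
-- vertex preceding position 0.
spineBefore : ℕ → (ℕ → ℕ) → ℕ → ℕ
spineBefore pv xs zero    = pv
spineBefore pv xs (suc j) = xs j

leavesAt : ℕ → (ℕ → ℕ) → (ℕ → ℕ) → ℕ → ℕ
leavesAt pv xs cs j = xs j * bit ((spineBefore pv xs j + xs (suc j)) + cs j ≡ᵇ 1) + cs j * bit (xs j ≡ᵇ 1)

profileLeaves : ℕ → (ℕ → ℕ) → (ℕ → ℕ) → ℕ → ℕ
profileLeaves pv xs cs zero    = 0
profileLeaves pv xs cs (suc k) =
  (xs 0 * bit ((pv + xs 1) + cs 0 ≡ᵇ 1) + cs 0 * bit (xs 0 ≡ᵇ 1))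
  + profileLeaves (xs 0) (λ j → xs (suc j)) (λ j → cs (suc j)) k

profileSize : (ℕ → ℕ) → (ℕ → ℕ) → ℕ → ℕ
profileSize xs cs k = sumUpTo k (λ j → xs j + cs j)

sumUpTo-leavesAt : ∀ k pv xs cs → sumUpTo k (leavesAt pv xs cs) ≡ profileLeaves pv xs cs k
sumUpTo-leavesAt zero    pv xs cs = refl
sumUpTo-leavesAt (suc k) pv xs cs = cong (leavesAt pv xs cs 0 +_)
  (trans (sumUpTo-cong k shift) (sumUpTo-leavesAt k (xs 0) (λ j → xs (suc j)) (λ j → cs (suc j))))
  where
  shift : ∀ j → leavesAt pv xs cs (suc j) ≡ leavesAt (xs 0) (λ j → xs (suc j)) (λ j → cs (suc j)) j
  shift zero    = refl
  shift (suc j) = refl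

profileLeaves-cong : ∀ k {pv pv′ xs xs′ cs cs′} → pv ≡ pv′ → (∀ j → xs j ≡ xs′ j) → (∀ j → cs j ≡ cs′ j) →
  profileLeaves pv xs cs k ≡ profileLeaves pv′ xs′ cs′ k
profileLeaves-cong zero    p ex ec = refl
profileLeaves-cong (suc k) p ex ec =
  cong₂ _+_ (cong₂ _+_ (cong₂ _*_ (ex 0) (cong (λ z → bit (z ≡ᵇ 1)) (cong₂ _+_ (cong₂ _+_ p (ex 1)) (ec 0))))
                       (cong₂ _*_ (ec 0) (cong (λ z → bit (z ≡ᵇ 1)) (ex 0))))
            (profileLeaves-cong k (ex 0) (λ j → ex (suc j)) (λ j → ec (suc j)))

profileLeaves-empty : ∀ k pv xs cs → (∀ j → xs j ≡ 0) → (∀ j → cs j ≡ 0) → profileLeaves pv xs cs k ≡ 0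
profileLeaves-empty zero    pv xs cs ex ec = refl
profileLeaves-empty (suc k) pv xs cs ex ec rewrite ex 0 | ec 0 =
  profileLeaves-empty k 0 _ _ (λ j → ex (suc j)) (λ j → ec (suc j))

spineProfile pendantProfile : List Label → ℕ → ℕ
spineProfile   M j = count (spine j) M
pendantProfile M j = count (leaf j) M

module _ (M : List Label) where

  leaves≡profileLeaves : ∀ k → (∀ ℓ → 1 ≤ count ℓ M → position ℓ < k) →
                         leaves M ≡ profileLeaves 0 (spineProfile M) (pendantProfile M) k
  leaves≡profileLeaves k bounded = begin
    leaves M
      ≡⟨ sumOver-cong M (λ a _ → cong (λ z → bit (z ≡ᵇ 1)) (degree≡ a)) ⟩
    sumOver isLeaf M
      ≡⟨ sumOver-byPosition k M isLeaf bounded ⟩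
    sumUpTo k (λ j → xs j * isLeaf (spine j) + cs j * isLeaf (leaf j))
      ≡⟨ sumUpTo-cong k (λ { zero → refl ; (suc j) → refl }) ⟩
    sumUpTo k (leavesAt 0 xs cs)
      ≡⟨ sumUpTo-leavesAt k 0 xs cs ⟩
    profileLeaves 0 xs cs k ∎
    where
    open ≡-Reasoning
    xs = spineProfile M
    cs = pendantProfile M
    degreeFormula : Label → ℕ
    degreeFormula (spine j) = (countBefore M j + count (spine (suc j)) M) + count (leaf j) M
    degreeFormula (leaf j)  = count (spine j) M
    isLeaf : Label → ℕ
    isLeaf a = bit (degreeFormula a ≡ᵇ 1)
    degree≡ : ∀ a → degree M a ≡ degreeFormula a
    degree≡ (spine j) = degree-spine M j
    degree≡ (leaf j)  = degree-leaf M j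

  length≡profileSize : ∀ k → (∀ ℓ → 1 ≤ count ℓ M → position ℓ < k) →
                       length M ≡ profileSize (spineProfile M) (pendantProfile M) k
  length≡profileSize k bounded =
    trans (length≡sumOver M)
          (trans (sumOver-byPosition k M (λ _ → 1) bounded)
                 (sumUpTo-cong k (λ j → cong₂ _+_ (*-identityʳ (count (spine j) M)) (*-identityʳ (count (leaf j) M)))))
    where
    length≡sumOver : ∀ M → length M ≡ sumOver (λ _ → 1) M
    length≡sumOver []      = refl
    length≡sumOver (a ∷ M) = cong suc (length≡sumOver M)

module _ (s : List ℕ) where
  private
    G    = caterpillar s
    labs = labels s

  degIn≡degree : ∀ X v → degIn G X v ≡ degree (selected labs X) (L.lookup labs v)
  degIn≡degree X v = ∣tabulate∣≡sumOver-selected labs X (λ a → labelAdj a (L.lookup labs v))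

  leavesIn≡leaves : ∀ X → leavesIn G X ≡ leaves (selected labs X)
  leavesIn≡leaves X =
    trans (cong ∣_∣ (VP.tabulate-cong (λ v → cong (λ z → lookup X v ∧ (z ≡ᵇ 1)) (degIn≡degree X v))))
          (∣tabulate∣≡sumOver-selected labs X (λ a → degree (selected labs X) a ≡ᵇ 1))

  connected-closed : ∀ X → Connected G X → (P : Label → Set) →
    (∀ a b → 1 ≤ count a (selected labs X) → 1 ≤ count b (selected labs X) → T (labelAdj a b) → P a → P b) →
    ∀ ℓ₀ ℓ → 1 ≤ count ℓ₀ (selected labs X) → 1 ≤ count ℓ (selected labs X) → P ℓ₀ → P ℓ
  connected-closed X conn P closed ℓ₀ ℓ c₀ c p₀
    with count-selected⇒vertex labs X ℓ₀ c₀ | count-selected⇒vertex labs X ℓ c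
  ... | v₀ , t₀ , e₀ | v , t , e = subst P e (along (conn v₀ v t₀ t) (subst P (sym e₀) p₀))
    where
    along : ∀ {u w} → Star (AdjIn G X) u w → P (L.lookup labs u) → P (L.lookup labs w)
    along ε p = p
    along ((iu , iw , a) ◅ st) p =
      along st (closed _ _ (count-selected-lookup labs X _ iu) (count-selected-lookup labs X _ iw) a p)

¬1≤⇒≡0 : ∀ {n} → ¬ (1 ≤ n) → n ≡ 0
¬1≤⇒≡0 h = n<1⇒n≡0 (≰⇒> h)

≤1⇒≡0⊎≡1 : ∀ {n} → n ≤ 1 → (n ≡ 0) ⊎ (n ≡ 1)
≤1⇒≡0⊎≡1 z≤n       = inj₁ refl
≤1⇒≡0⊎≡1 (s≤s z≤n) = inj₂ refl

record Profile (s : List ℕ) (xs cs : ℕ → ℕ) : Set where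
  field
    spine≤1       : ∀ j → xs j ≤ 1
    pendants≤     : ∀ j → cs j ≤ entry s j
    spine-beyond  : ∀ j → length s ≤ j → xs j ≡ 0
    spine-convex  : ∀ a j b → a < j → j < b → 1 ≤ xs a → 1 ≤ xs b → 1 ≤ xs j
    pendant⇒spine : ∀ j → 1 ≤ cs j → 1 ≤ xs j
open Profile

record EmptyFrom (j : ℕ) (xs cs : ℕ → ℕ) : Set where
  field emptyAt : ∀ q → (xs (j + q) ≡ 0) × (cs (j + q) ≡ 0)
open EmptyFrom

profile-emptyFrom : ∀ {s xs cs} → Profile s xs cs → ∀ a j → 1 ≤ xs a → a < j → xs j ≡ 0 → EmptyFrom j xs cs
profile-emptyFrom {xs = xs} {cs} P a j xa a<j xj = record { emptyAt = λ q → spineGone q , pendantsGone q }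
  where
  spineGone : ∀ q → xs (j + q) ≡ 0
  spineGone q with m≤n⇒m<n∨m≡n (m≤m+n j q)
  ... | inj₂ j≡j+q = trans (cong xs (sym j≡j+q)) xj
  ... | inj₁ j<j+q = ¬1≤⇒≡0 (λ c → n≮0 (subst (1 ≤_) xj (spine-convex P a j (j + q) a<j j<j+q xa c)))
  pendantsGone : ∀ q → cs (j + q) ≡ 0
  pendantsGone q = ¬1≤⇒≡0 (λ c → n≮0 (subst (1 ≤_) (spineGone q) (pendant⇒spine P (j + q) c)))

profileSize-emptyFrom : ∀ {j xs cs} → EmptyFrom j xs cs → ∀ k → profileSize (λ q → xs (j + q)) (λ q → cs (j + q)) k ≡ 0
profileSize-emptyFrom e k = sumUpTo-zero k (λ q → cong₂ _+_ (proj₁ (emptyAt e q)) (proj₂ (emptyAt e q)))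

profileLeaves-emptyFrom : ∀ {j xs cs} → EmptyFrom j xs cs → ∀ pv k → profileLeaves pv (λ q → xs (j + q)) (λ q → cs (j + q)) k ≡ 0
profileLeaves-emptyFrom e pv k = profileLeaves-empty k pv _ _ (λ q → proj₁ (emptyAt e q)) (λ q → proj₂ (emptyAt e q))

profileSize-absentHead : ∀ {xs cs} k → xs 0 ≡ 0 → cs 0 ≡ 0 →
  profileSize xs cs (suc k) ≡ profileSize (λ j → xs (suc j)) (λ j → cs (suc j)) k
profileSize-absentHead {xs} {cs} k x₀ c₀ = cong₂ (λ a b → (a + b) + profileSize (λ j → xs (suc j)) (λ j → cs (suc j)) k) x₀ c₀

profileLeaves-absentHead : ∀ {pv xs cs} k → xs 0 ≡ 0 → cs 0 ≡ 0 →
  profileLeaves pv xs cs (suc k) ≡ profileLeaves 0 (λ j → xs (suc j)) (λ j → cs (suc j)) k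
profileLeaves-absentHead {pv} {xs} {cs} k x₀ c₀ =
  cong₂ (λ a b → (a * bit ((pv + xs 1) + b ≡ᵇ 1) + b * bit (a ≡ᵇ 1)) + profileLeaves a (λ j → xs (suc j)) (λ j → cs (suc j)) k) x₀ c₀

Profile-tail : ∀ {t t′ s xs cs} → Profile (t ∷ t′ ∷ s) xs cs →
  Profile (suc t′ ∷ s) (λ j → xs (suc j)) (λ j → cs (suc j))
Profile-tail P = record
  { spine≤1       = λ j → spine≤1 P (suc j)
  ; pendants≤     = λ { zero → ≤-trans (pendants≤ P 1) (n≤1+n _) ; (suc j) → pendants≤ P (suc (suc j)) }
  ; spine-beyond  = λ j le → spine-beyond P (suc j) (s≤s le)
  ; spine-convex  = λ a j b a<j j<b xa xb → spine-convex P (suc a) (suc j) (suc b) (s≤s a<j) (s≤s j<b) xa xb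
  ; pendant⇒spine = λ j c → pendant⇒spine P (suc j) c
  }

-- spine vertex 0, a leaf of the tree, regarded as a pendant leaf of spine vertex 1
reattached : (ℕ → ℕ) → ℕ → ℕ
reattached cs zero    = suc (cs 1)
reattached cs (suc j) = cs (suc (suc j))

Profile-reattach : ∀ {t t′ s xs cs} → Profile (t ∷ t′ ∷ s) xs cs → xs 1 ≡ 1 →
  Profile (suc t′ ∷ s) (λ j → xs (suc j)) (reattached cs)
Profile-reattach P x₁ = record
  { spine≤1       = λ j → spine≤1 P (suc j)
  ; pendants≤     = λ { zero → s≤s (pendants≤ P 1) ; (suc j) → pendants≤ P (suc (suc j)) }
  ; spine-beyond  = λ j le → spine-beyond P (suc j) (s≤s le)
  ; spine-convex  = λ a j b a<j j<b xa xb → spine-convex P (suc a) (suc j) (suc b) (s≤s a<j) (s≤s j<b) xa xb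
  ; pendant⇒spine = λ { zero _ → ≤-reflexive (sym x₁) ; (suc j) c → pendant⇒spine P (suc (suc j)) c }
  }

-- spine vertices 0 and 1 contracted into one, which keeps the pendant leaves of both
mergedSpine mergedPendants : (ℕ → ℕ) → ℕ → ℕ
mergedSpine xs zero    = 1
mergedSpine xs (suc j) = xs (suc (suc j))
mergedPendants cs zero    = cs 0 + cs 1
mergedPendants cs (suc j) = cs (suc (suc j))

Profile-merge : ∀ {t t′ s xs cs} → Profile (suc t ∷ t′ ∷ s) xs cs → xs 0 ≡ 1 →
  Profile (suc (t + t′) ∷ s) (mergedSpine xs) (mergedPendants cs)
Profile-merge {xs = xs} P x₀ = record
  { spine≤1       = λ { zero → ≤-refl ; (suc j) → spine≤1 P (suc (suc j)) }
  ; pendants≤     = λ { zero → +-mono-≤ (pendants≤ P 0) (pendants≤ P 1) ; (suc j) → pendants≤ P (suc (suc j)) }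
  ; spine-beyond  = λ { zero () ; (suc j) (s≤s le) → spine-beyond P (suc (suc j)) (s≤s (s≤s le)) }
  ; spine-convex  = convex
  ; pendant⇒spine = λ { zero _ → ≤-refl ; (suc j) c → pendant⇒spine P (suc (suc j)) c }
  }
  where
  convex : ∀ a j b → a < j → j < b → 1 ≤ mergedSpine xs a → 1 ≤ mergedSpine xs b → 1 ≤ mergedSpine xs j
  convex zero    (suc j) (suc b) _   j<b _  xb =
    spine-convex P 0 (suc (suc j)) (suc (suc b)) (s≤s z≤n) (s≤s j<b) (≤-reflexive (sym x₀)) xb
  convex (suc a) (suc j) (suc b) a<j j<b xa xb =
    spine-convex P (suc (suc a)) (suc (suc j)) (suc (suc b)) (s≤s a<j) (s≤s j<b) xa xb

profileSize-≤ : ∀ s {xs cs} → Profile s xs cs → profileSize xs cs (length s) ≤ length (encode s)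
profileSize-≤ s P = go s (spine≤1 P) (pendants≤ P)
  where
  go : ∀ s {xs cs} → (∀ j → xs j ≤ 1) → (∀ j → cs j ≤ entry s j) → profileSize xs cs (length s) ≤ length (encode s)
  go []      _  _  = z≤n
  go (t ∷ s) h₁ h₂ = ≤-trans (+-mono-≤ (+-mono-≤ (h₁ 0) (h₂ 0)) (go s (λ j → h₁ (suc j)) (λ j → h₂ (suc j))))
                             (≤-reflexive (sym (length-encode-∷ t s)))

-- Upper bound on the leaves of a profile

ones-take-replicate-true : ∀ n t (Y : Word) → n ≤ t → ones (take n (replicate t true ++ Y)) ≡ n
ones-take-replicate-true zero    t       Y _         = refl
ones-take-replicate-true (suc n) (suc t) Y (s≤s n≤t) = cong suc (ones-take-replicate-true n t Y n≤t)

ones-take-insert-false : ∀ (A B : Word) n → ones (take n (A ++ B)) ≤ ones (take (suc n) (A ++ false ∷ B))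
ones-take-insert-false []      B n       = ≤-refl
ones-take-insert-false (a ∷ A) B zero    = z≤n
ones-take-insert-false (a ∷ A) B (suc n) = +-monoʳ-≤ (bit a) (ones-take-insert-false A B n)

BoundedByFactor : List ℕ → ℕ → ℕ → Set
BoundedByFactor s i n =
  Σ ℕ λ p → (p + i ≤ length (encode s)) × (n ≤ 2 + ones (take (i ∸ 3) (drop p (innerWord s))))

boundedByFactor-∷ : ∀ t t′ s i n → BoundedByFactor (suc t′ ∷ s) i n → BoundedByFactor (suc t ∷ t′ ∷ s) i n
boundedByFactor-∷ t t′ s i n (p , p+i≤ , n≤) = suc t + p , fits , subst (λ z → n ≤ 2 + ones (take (i ∸ 3) z)) shifted n≤
  where
  fits : (suc t + p) + i ≤ length (encode (suc t ∷ t′ ∷ s))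
  fits = begin
    (suc t + p) + i                         ≡⟨ +-assoc (suc t) p i ⟩
    suc t + (p + i)                         ≤⟨ +-monoʳ-≤ (suc t) p+i≤ ⟩
    suc t + length (encode (suc t′ ∷ s))    ≡⟨ cong (suc t +_) (length-encode-∷ (suc t′) s) ⟩
    suc t + suc (suc t′ + length (encode s)) ≡⟨ regroup t t′ (length (encode s)) ⟩
    suc (suc t + suc (t′ + length (encode s))) ≡⟨ cong (λ n → suc (suc t + n)) (length-encode-∷ t′ s) ⟨
    suc (suc t + length (encode (t′ ∷ s))) ≡⟨ length-encode-∷ (suc t) (t′ ∷ s) ⟨
    length (encode (suc t ∷ t′ ∷ s))        ∎
    where
    open ≤-Reasoning
    regroup : ∀ t t′ n → suc t + suc (suc t′ + n) ≡ suc (suc t + suc (t′ + n))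
    regroup = solve-∀
  skip : ∀ t (Y : Word) → drop (suc t) (replicate t true ++ false ∷ Y) ≡ Y
  skip zero    Y = refl
  skip (suc t) Y = skip t Y
  shifted : drop p (innerWord (suc t′ ∷ s)) ≡ drop (suc t + p) (innerWord (suc t ∷ t′ ∷ s))
  shifted = trans (cong (drop p) (sym (skip t (replicate t′ true ++ encode s))))
                  (LP.drop-drop (suc t) p (innerWord (suc t ∷ t′ ∷ s)))

boundedWithinFirstBlock : ∀ t s m n i → n ≡ 1 + m → i ≡ 2 + m → m ≤ suc t →
                          n ≤ 2 + ones (take (i ∸ 3) (innerWord (suc t ∷ s)))
boundedWithinFirstBlock t s m n i refl refl m≤1+t = begin
  1 + m                                         ≤⟨ +-monoʳ-≤ 1 (m≤n+m∸n m 1) ⟩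
  2 + (m ∸ 1)                                   ≡⟨ cong (2 +_) (ones-take-replicate-true (m ∸ 1) t (encode s) m∸1≤t) ⟨
  2 + ones (take (m ∸ 1) (replicate t true ++ encode s)) ∎
  where
  open ≤-Reasoning
  m∸1≤t : m ∸ 1 ≤ t
  m∸1≤t = ∸-monoˡ-≤ 1 m≤1+t

leavesAt01-star : ∀ x₀ x₁ c₀ c T → x₀ ≡ 1 → x₁ ≡ 0 → c₀ ≡ suc (suc c) → T ≡ 0 →
  (x₀ * bit ((0 + x₁) + c₀ ≡ᵇ 1) + c₀ * bit (x₀ ≡ᵇ 1)) + T ≡ 1 + suc c
leavesAt01-star _ _ _ c _ refl refl refl refl = trans (+-identityʳ _) (*-identityʳ (suc (suc c)))

leavesAt01-path : ∀ x₀ x₁ x₂ c₀ c₁ T → x₀ ≡ 1 → x₁ ≡ 1 → x₂ ≡ 0 → 1 ≤ c₀ → c₁ ≡ 0 → T ≡ 0 →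
  (x₀ * bit ((0 + x₁) + c₀ ≡ᵇ 1) + c₀ * bit (x₀ ≡ᵇ 1))
  + ((x₁ * bit ((x₀ + x₂) + c₁ ≡ᵇ 1) + c₁ * bit (x₁ ≡ᵇ 1)) + T) ≡ 1 + c₀
leavesAt01-path _ _ _ (suc c) _ _ refl refl refl (s≤s z≤n) refl refl =
  trans (cong (_+ 1) (*-identityʳ (suc c))) (+-comm (suc c) 1)

leavesAt01-merge : ∀ x₀ x₁ x₂ c₀ c₁ T T′ → x₀ ≡ 1 → x₁ ≡ 1 → 1 ≤ c₀ → 1 ≤ x₂ + c₁ → T ≡ T′ →
  (x₀ * bit ((0 + x₁) + c₀ ≡ᵇ 1) + c₀ * bit (x₀ ≡ᵇ 1))
  + ((x₁ * bit ((x₀ + x₂) + c₁ ≡ᵇ 1) + c₁ * bit (x₁ ≡ᵇ 1)) + T)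
  ≡ (1 * bit ((0 + x₂) + (c₀ + c₁) ≡ᵇ 1) + (c₀ + c₁) * bit (1 ≡ᵇ 1)) + T′
leavesAt01-merge _ _ x₂ (suc c) c₁ T _ refl refl (s≤s z≤n) pos refl
  rewrite bit-≡ᵇ1 (suc (x₂ + c₁)) (s≤s pos) | +-suc x₂ (c + c₁)
        | bit-≡ᵇ1 (suc (x₂ + (c + c₁))) (s≤s (≤-trans pos (+-monoʳ-≤ x₂ (m≤n+m c₁ c))))
  = regroup c c₁ T
  where
  regroup : ∀ c c₁ T → (0 + suc c * 1) + ((0 + c₁ * 1) + T) ≡ (0 + (suc c + c₁) * 1) + T
  regroup = solve-∀

leavesAt01-reattach : ∀ x₀ x₁ x₂ c₀ c₁ T → x₀ ≡ 1 → c₀ ≡ 0 → x₁ ≡ 1 →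
  (x₀ * bit ((0 + x₁) + c₀ ≡ᵇ 1) + c₀ * bit (x₀ ≡ᵇ 1)) + ((x₁ * bit ((x₀ + x₂) + c₁ ≡ᵇ 1) + c₁ * bit (x₁ ≡ᵇ 1)) + T)
  ≡ (x₁ * bit ((0 + x₂) + suc c₁ ≡ᵇ 1) + suc c₁ * bit (x₁ ≡ᵇ 1)) + T
leavesAt01-reattach _ _ x₂ _ c₁ T refl refl refl rewrite +-suc x₂ c₁ = regroup (bit (suc (x₂ + c₁) ≡ᵇ 1)) c₁ T
  where
  regroup : ∀ B c T → (1 * 1 + 0 * 1) + ((1 * B + c * 1) + T) ≡ (1 * B + suc c * 1) + T
  regroup = solve-∀

starBound : ∀ t s xs cs → Profile (suc t ∷ s) xs cs → xs 0 ≡ 1 → xs 1 ≡ 0 → 1 ≤ cs 0 →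
  ∀ i → profileSize xs cs (suc (length s)) ≡ i → 3 ≤ i →
  profileLeaves 0 xs cs (suc (length s)) ≤ 2 + ones (take (i ∸ 3) (innerWord (suc t ∷ s)))
starBound t s xs cs P x₀ x₁ c₀ i size≡i i≥3 = star (cs 0) refl
  where
  empty : EmptyFrom 1 xs cs
  empty = profile-emptyFrom P 0 1 (≤-reflexive (sym x₀)) (s≤s z≤n) x₁
  i≡ : i ≡ 1 + cs 0
  i≡ = trans (sym size≡i) (trans (cong₂ _+_ (cong (_+ cs 0) x₀) (profileSize-emptyFrom empty (length s))) (+-identityʳ _))
  star : ∀ c → cs 0 ≡ c → profileLeaves 0 xs cs (suc (length s)) ≤ 2 + ones (take (i ∸ 3) (innerWord (suc t ∷ s)))
  star zero          e = ⊥-elim (n≮0 (subst (1 ≤_) e c₀))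
  star (suc zero)    e = ⊥-elim (m+1+n≰m 2 (subst (3 ≤_) (trans i≡ (cong suc e)) i≥3))
  star (suc (suc c)) e = boundedWithinFirstBlock t s (suc c) _ i
    (leavesAt01-star (xs 0) (xs 1) (cs 0) c _ x₀ x₁ e (profileLeaves-emptyFrom empty (xs 0) (length s)))
    (trans i≡ (cong suc e)) (≤-trans (n≤1+n _) (subst (_≤ suc t) e (pendants≤ P 0)))

pathBound : ∀ t t′ s xs cs → Profile (suc t ∷ t′ ∷ s) xs cs → xs 0 ≡ 1 → xs 1 ≡ 1 → 1 ≤ cs 0 → xs 2 + cs 1 ≡ 0 →
  ∀ i → profileSize xs cs (2 + length s) ≡ i →
  profileLeaves 0 xs cs (2 + length s) ≤ 2 + ones (take (i ∸ 3) (innerWord (suc t ∷ t′ ∷ s)))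
pathBound t t′ s xs cs P x₀ x₁ c₀ x₂+c₁≡0 i size≡i = boundedWithinFirstBlock t (t′ ∷ s) (cs 0) _ i
  (leavesAt01-path (xs 0) (xs 1) (xs 2) (cs 0) (cs 1) _ x₀ x₁ x₂ c₀ c₁ (profileLeaves-emptyFrom empty (xs 1) (length s)))
  i≡ (pendants≤ P 0)
  where
  x₂ : xs 2 ≡ 0
  x₂ = m+n≡0⇒m≡0 (xs 2) x₂+c₁≡0
  c₁ : cs 1 ≡ 0
  c₁ = m+n≡0⇒n≡0 (xs 2) x₂+c₁≡0
  empty : EmptyFrom 2 xs cs
  empty = profile-emptyFrom P 1 2 (≤-reflexive (sym x₁)) ≤-refl x₂
  regroup : ∀ c → (1 + c) + ((1 + 0) + 0) ≡ 2 + c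
  regroup = solve-∀
  i≡ : i ≡ 2 + cs 0
  i≡ = trans (sym size≡i)
             (trans (cong₂ _+_ (cong (_+ cs 0) x₀) (cong₂ _+_ (cong₂ _+_ x₁ c₁) (profileSize-emptyFrom empty (length s))))
                    (regroup (cs 0)))

-- Induction on the sequence: the first spine vertex is either absent (drop it), a leaf of the
-- tree (re-read it as a pendant leaf of the next one), the centre of a star, or it is merged with
-- the next spine vertex, which deletes a letter 0 from the word and shrinks the tree by one vertex.
rootedBound : ∀ t s xs cs → Profile (suc t ∷ s) xs cs → xs 0 ≡ 1 → 1 ≤ cs 0 →
  ∀ i → profileSize xs cs (suc (length s)) ≡ i → 3 ≤ i →
  profileLeaves 0 xs cs (suc (length s)) ≤ 2 + ones (take (i ∸ 3) (innerWord (suc t ∷ s)))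

mergeBound : ∀ t t′ s xs cs → Profile (suc t ∷ t′ ∷ s) xs cs → xs 0 ≡ 1 → xs 1 ≡ 1 → 1 ≤ cs 0 → 1 ≤ xs 2 + cs 1 →
  ∀ i → profileSize xs cs (2 + length s) ≡ i → 3 ≤ i →
  profileLeaves 0 xs cs (2 + length s) ≤ 2 + ones (take (i ∸ 3) (innerWord (suc t ∷ t′ ∷ s)))

rootedBound t s xs cs P x₀ c₀ i size≡i i≥3 with ≤1⇒≡0⊎≡1 (spine≤1 P 1)
... | inj₁ x₁ = starBound t s xs cs P x₀ x₁ c₀ i size≡i i≥3
rootedBound t []       xs cs P x₀ c₀ i size≡i i≥3 | inj₂ x₁ = ⊥-elim (0≢1+n (trans (sym (spine-beyond P 1 ≤-refl)) x₁))
rootedBound t (t′ ∷ s) xs cs P x₀ c₀ i size≡i i≥3 | inj₂ x₁ with 1 ≤? xs 2 + cs 1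
... | yes pos  = mergeBound t t′ s xs cs P x₀ x₁ c₀ pos i size≡i i≥3
... | no  ¬pos = pathBound t t′ s xs cs P x₀ x₁ c₀ (¬1≤⇒≡0 ¬pos) i size≡i

mergeBound t t′ s xs cs P x₀ x₁ c₀ pos i size≡i i≥3 = begin
  profileLeaves 0 xs cs (2 + length s)
    ≡⟨ leavesAt01-merge (xs 0) (xs 1) (xs 2) (cs 0) (cs 1) _ _ x₀ x₁ c₀ pos
         (cong (λ z → profileLeaves z (λ j → xs (suc (suc j))) (λ j → cs (suc (suc j))) (length s)) x₁) ⟩
  profileLeaves 0 (mergedSpine xs) (mergedPendants cs) (suc (length s))
    ≤⟨ rootedBound (t + t′) s _ _ (Profile-merge P x₀) refl (≤-trans c₀ (m≤m+n (cs 0) (cs 1))) i⁺ refl i⁺≥3 ⟩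
  2 + ones (take (i⁺ ∸ 3) (innerWord (suc (t + t′) ∷ s)))
    ≤⟨ +-monoʳ-≤ 2 onesGrow ⟩
  2 + ones (take (i ∸ 3) (innerWord (suc t ∷ t′ ∷ s))) ∎
  where
  open ≤-Reasoning
  R  = sumUpTo (length s) (λ j → xs (suc (suc j)) + cs (suc (suc j)))
  i⁺ = profileSize (mergedSpine xs) (mergedPendants cs) (suc (length s))
  x₂≤R : xs 2 ≤ R
  x₂≤R = firstOfRest s P
    where
    firstOfRest : ∀ s → Profile (suc t ∷ t′ ∷ s) xs cs → xs 2 ≤ sumUpTo (length s) (λ j → xs (suc (suc j)) + cs (suc (suc j)))
    firstOfRest []      P = ≤-reflexive (spine-beyond P 2 ≤-refl)
    firstOfRest (_ ∷ _) _ = ≤-trans (m≤m+n (xs 2) (cs 2)) (m≤m+n _ _)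
  i⁺≥3 : 3 ≤ i⁺
  i⁺≥3 = s≤s (≤-trans (+-mono-≤ c₀ (≤-trans pos (≤-trans (≤-reflexive (+-comm (xs 2) (cs 1))) (+-monoʳ-≤ (cs 1) x₂≤R))))
                      (≤-reflexive (sym (+-assoc (cs 0) (cs 1) R))))
  i≡ : i ≡ suc i⁺
  i≡ = trans (sym size≡i) (trans (cong₂ (λ a b → (a + cs 0) + ((b + cs 1) + R)) x₀ x₁) (regroup (cs 0) (cs 1) R))
    where
    regroup : ∀ a b R → (1 + a) + ((1 + b) + R) ≡ suc ((1 + (a + b)) + R)
    regroup = solve-∀
  onesGrow : ones (take (i⁺ ∸ 3) (innerWord (suc (t + t′) ∷ s))) ≤ ones (take (i ∸ 3) (innerWord (suc t ∷ t′ ∷ s)))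
  onesGrow = subst₂ (λ a b → ones (take (i⁺ ∸ 3) a) ≤ ones (take b (innerWord (suc t ∷ t′ ∷ s))))
                    (sym merged) (sym (trans (cong (_∸ 3) i≡) (+-∸-assoc 1 i⁺≥3)))
                    (ones-take-insert-false (replicate t true) (replicate t′ true ++ encode s) (i⁺ ∸ 3))
    where
    merged : innerWord (suc (t + t′) ∷ s) ≡ replicate t true ++ (replicate t′ true ++ encode s)
    merged = trans (cong (_++ encode s) (replicate-+ t t′ true)) (LP.++-assoc (replicate t true) (replicate t′ true) (encode s))

factorBound : ∀ t s xs cs → Profile (suc t ∷ s) xs cs →
  ∀ i → profileSize xs cs (suc (length s)) ≡ i → 3 ≤ i →
  BoundedByFactor (suc t ∷ s) i (profileLeaves 0 xs cs (suc (length s)))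

absentRootBound : ∀ t s xs cs → Profile (suc t ∷ s) xs cs → xs 0 ≡ 0 →
  ∀ i → profileSize xs cs (suc (length s)) ≡ i → 3 ≤ i →
  BoundedByFactor (suc t ∷ s) i (profileLeaves 0 xs cs (suc (length s)))

leafRootBound : ∀ t s xs cs → Profile (suc t ∷ s) xs cs → xs 0 ≡ 1 → cs 0 ≡ 0 →
  ∀ i → profileSize xs cs (suc (length s)) ≡ i → 3 ≤ i →
  BoundedByFactor (suc t ∷ s) i (profileLeaves 0 xs cs (suc (length s)))

factorBound t s xs cs P i size≡i i≥3 with ≤1⇒≡0⊎≡1 (spine≤1 P 0)
... | inj₁ x₀ = absentRootBound t s xs cs P x₀ i size≡i i≥3
... | inj₂ x₀ with 1 ≤? cs 0
...   | yes c₀ = 0 , subst (_≤ length (encode (suc t ∷ s))) size≡i (profileSize-≤ (suc t ∷ s) P)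
                   , rootedBound t s xs cs P x₀ c₀ i size≡i i≥3
...   | no ¬c₀ = leafRootBound t s xs cs P x₀ (¬1≤⇒≡0 ¬c₀) i size≡i i≥3

absentRootBound t s xs cs P x₀ i size≡i i≥3 = go s P size≡i
  where
  c₀ : cs 0 ≡ 0
  c₀ = ¬1≤⇒≡0 (λ c → n≮0 (subst (1 ≤_) x₀ (pendant⇒spine P 0 c)))
  go : ∀ s → Profile (suc t ∷ s) xs cs → profileSize xs cs (suc (length s)) ≡ i →
       BoundedByFactor (suc t ∷ s) i (profileLeaves 0 xs cs (suc (length s)))
  go []       P size≡i = ⊥-elim (n≮0 (≤-trans (s≤s z≤n) (subst (3 ≤_) (trans (sym size≡i) (profileSize-absentHead {xs} {cs} 0 x₀ c₀)) i≥3)))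
  go (t′ ∷ s) P size≡i =
    boundedByFactor-∷ t t′ s i _
      (subst (BoundedByFactor (suc t′ ∷ s) i) (sym (profileLeaves-absentHead {0} {xs} {cs} (suc (length s)) x₀ c₀))
             (factorBound t′ s _ _ (Profile-tail P) i (trans (sym (profileSize-absentHead {xs} {cs} (suc (length s)) x₀ c₀)) size≡i) i≥3))

leafRootBound t s xs cs P x₀ c₀ i size≡i i≥3 with ≤1⇒≡0⊎≡1 (spine≤1 P 1)
... | inj₁ x₁ = ⊥-elim (m+1+n≰m 1 (subst (3 ≤_) i≡1 i≥3))
  where
  empty : EmptyFrom 1 xs cs
  empty = profile-emptyFrom P 0 1 (≤-reflexive (sym x₀)) (s≤s z≤n) x₁
  i≡1 : i ≡ 1
  i≡1 = trans (sym size≡i) (cong₂ _+_ (cong₂ _+_ x₀ c₀) (profileSize-emptyFrom empty (length s)))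
leafRootBound t []       xs cs P x₀ c₀ i size≡i i≥3 | inj₂ x₁ = ⊥-elim (0≢1+n (trans (sym (spine-beyond P 1 ≤-refl)) x₁))
leafRootBound t (t′ ∷ s) xs cs P x₀ c₀ i size≡i i≥3 | inj₂ x₁ =
  boundedByFactor-∷ t t′ s i _
    (subst (BoundedByFactor (suc t′ ∷ s) i)
           (sym (leavesAt01-reattach (xs 0) (xs 1) (xs 2) (cs 0) (cs 1) _ x₀ c₀ x₁))
           (factorBound t′ s _ (reattached cs) (Profile-reattach P x₁) i size≡i′ i≥3))
  where
  size≡i′ : profileSize (λ j → xs (suc j)) (reattached cs) (suc (length s)) ≡ i
  size≡i′ = begin
    (xs 1 + suc (cs 1)) + R                  ≡⟨ cong (λ a → (a + suc (cs 1)) + R) x₁ ⟩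
    (1 + suc (cs 1)) + R                     ≡⟨ regroup (cs 1) R ⟨
    (1 + 0) + ((1 + cs 1) + R)               ≡⟨ cong (λ a → (1 + 0) + ((a + cs 1) + R)) x₁ ⟨
    (1 + 0) + ((xs 1 + cs 1) + R)            ≡⟨ cong₂ (λ a b → (a + b) + ((xs 1 + cs 1) + R)) x₀ c₀ ⟨
    (xs 0 + cs 0) + ((xs 1 + cs 1) + R)      ≡⟨ size≡i ⟩
    i                                        ∎
    where
    open ≡-Reasoning
    R = sumUpTo (length s) (λ j → xs (suc (suc j)) + cs (suc (suc j)))
    regroup : ∀ c R → (1 + 0) + ((1 + c) + R) ≡ (1 + suc c) + R
    regroup = solve-∀

prefixSpine : List ℕ → ℕ → ℕ → ℕ
prefixSpine [] b j = 0
prefixSpine (t ∷ s) zero j = 0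
prefixSpine (t ∷ s) (suc b) zero = 1
prefixSpine (t ∷ s) (suc b) (suc j) = prefixSpine s (b ∸ t) j

prefixPendants : List ℕ → ℕ → ℕ → ℕ
prefixPendants [] b j = 0
prefixPendants (t ∷ s) zero j = 0
prefixPendants (t ∷ s) (suc b) zero = t ⊓ b
prefixPendants (t ∷ s) (suc b) (suc j) = prefixPendants s (b ∸ t) j

trailingZero : Word → ℕ
trailingZero [] = 0
trailingZero (b ∷ []) = bit (not b)
trailingZero (b ∷ c ∷ r) = trailingZero (c ∷ r)

prefixSpine-empty : ∀ s j → prefixSpine s 0 j ≡ 0
prefixSpine-empty [] j = refl
prefixSpine-empty (t ∷ s) j = refl

prefixPendants-empty : ∀ s j → prefixPendants s 0 j ≡ 0
prefixPendants-empty [] j = refl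
prefixPendants-empty (t ∷ s) j = refl

prefixSpine≤1 : ∀ s b j → prefixSpine s b j ≤ 1
prefixSpine≤1 [] b j = z≤n
prefixSpine≤1 (t ∷ s) zero j = z≤n
prefixSpine≤1 (t ∷ s) (suc b) zero = ≤-refl
prefixSpine≤1 (t ∷ s) (suc b) (suc j) = prefixSpine≤1 s (b ∸ t) j

prefixSpine⇒<length : ∀ s b j → 1 ≤ prefixSpine s b j → j < length s
prefixSpine⇒<length [] b j ()
prefixSpine⇒<length (t ∷ s) zero j ()
prefixSpine⇒<length (t ∷ s) (suc b) zero h = s≤s z≤n
prefixSpine⇒<length (t ∷ s) (suc b) (suc j) h = s≤s (prefixSpine⇒<length s (b ∸ t) j h)

prefixPendants≤ : ∀ s b j → prefixPendants s b j ≤ entry s j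
prefixPendants≤ [] b j = z≤n
prefixPendants≤ (t ∷ s) zero j = z≤n
prefixPendants≤ (t ∷ s) (suc b) zero = m⊓n≤m t b
prefixPendants≤ (t ∷ s) (suc b) (suc j) = prefixPendants≤ s (b ∸ t) j

prefixSpine-pred : ∀ s b j → 1 ≤ prefixSpine s b (suc j) → 1 ≤ prefixSpine s b j
prefixSpine-pred [] b j ()
prefixSpine-pred (t ∷ s) zero j ()
prefixSpine-pred (t ∷ s) (suc b) zero h = ≤-refl
prefixSpine-pred (t ∷ s) (suc b) (suc j) h = prefixSpine-pred s (b ∸ t) j h

prefixPendants⇒prefixSpine : ∀ s b j → 1 ≤ prefixPendants s b j → 1 ≤ prefixSpine s b j
prefixPendants⇒prefixSpine [] b j ()
prefixPendants⇒prefixSpine (t ∷ s) zero j ()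
prefixPendants⇒prefixSpine (t ∷ s) (suc b) zero h = ≤-refl
prefixPendants⇒prefixSpine (t ∷ s) (suc b) (suc j) h = prefixPendants⇒prefixSpine s (b ∸ t) j h

profileSize-prefix : ∀ s b → b ≤ length (encode s) → profileSize (prefixSpine s b) (prefixPendants s b) (length s) ≡ b
profileSize-prefix [] zero le = refl
profileSize-prefix (t ∷ s) zero le = sumUpTo-zero (suc (length s)) (λ j → refl)
profileSize-prefix (t ∷ s) (suc b) le with b N.≤? t
... | yes bt rewrite m≤n⇒m∸n≡0 bt | m≥n⇒m⊓n≡n bt | profileSize-prefix s 0 z≤n = cong suc (+-identityʳ b)
... | no nbt = trans (cong (λ z → suc (t ⊓ b + z)) (profileSize-prefix s (b ∸ t) le')) (cong suc (trans (cong (_+ (b ∸ t)) (m≤n⇒m⊓n≡m tb)) (m+[n∸m]≡n tb)))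
  where
  tb : t ≤ b
  tb = ≤-trans (n≤1+n t) (≰⇒> nbt)
  le' : b ∸ t ≤ length (encode s)
  le' = ≤-trans (∸-monoˡ-≤ t (≤-pred (≤-trans le (≤-reflexive (length-encode-∷ t s))))) (≤-reflexive (m+n∸m≡n t (length (encode s))))

take-replicate-true : ∀ b t (Y : Word) → b ≤ t → take b (replicate t true ++ Y) ≡ replicate b true
take-replicate-true zero t Y le = refl
take-replicate-true (suc b) (suc t) Y (s≤s le) = cong (true ∷_) (take-replicate-true b t Y le)

take-replicate-true-++ : ∀ t m (Y : Word) → take (t + m) (replicate t true ++ Y) ≡ replicate t true ++ take m Y
take-replicate-true-++ zero m Y = refl
take-replicate-true-++ (suc t) m Y = cong (true ∷_) (take-replicate-true-++ t m Y)

trailingZero-true∷replicate : ∀ b → trailingZero (true ∷ replicate b true) ≡ 0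
trailingZero-true∷replicate zero = refl
trailingZero-true∷replicate (suc b) = trailingZero-true∷replicate b

trailingZero-block : ∀ b → trailingZero (false ∷ replicate b true) ≡ bit (b ≡ᵇ 0)
trailingZero-block zero = refl
trailingZero-block (suc b) = trailingZero-true∷replicate b

trailingZero-++ : ∀ (A : Word) q Q → trailingZero (A ++ q ∷ Q) ≡ trailingZero (q ∷ Q)
trailingZero-++ [] q Q = refl
trailingZero-++ (a ∷ []) q Q = refl
trailingZero-++ (a ∷ a' ∷ A) q Q = trailingZero-++ (a' ∷ A) q Q

onesTrailing-afterFirstBlock : ∀ t c t′ s → let Q = take (suc c) (encode (t′ ∷ s)) in
  ones (take (suc (t + suc c)) (encode (t ∷ t′ ∷ s))) + trailingZero (take (suc (t + suc c)) (encode (t ∷ t′ ∷ s)))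
  ≡ (t + ones Q) + trailingZero Q
onesTrailing-afterFirstBlock t c t′ s = begin
  ones (false ∷ take (t + suc c) (replicate t true ++ encode (t′ ∷ s)))
    + trailingZero (false ∷ take (t + suc c) (replicate t true ++ encode (t′ ∷ s)))
    ≡⟨ cong (λ z → ones (false ∷ z) + trailingZero (false ∷ z)) (take-replicate-true-++ t (suc c) (encode (t′ ∷ s))) ⟩
  ones (replicate t true ++ Q) + trailingZero ((false ∷ replicate t true) ++ false ∷ take c (replicate t′ true ++ encode s))
    ≡⟨ cong₂ _+_ (trans (ones-++ (replicate t true) Q) (cong (_+ ones Q) (ones-replicate-true t)))
                 (trailingZero-++ (false ∷ replicate t true) false _) ⟩
  (t + ones Q) + trailingZero Q ∎
  where
  open ≡-Reasoning
  Q = take (suc c) (encode (t′ ∷ s))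

beyondFirstBlock : ∀ t b → ¬ (b ≤ t) → Σ ℕ λ c → (b ∸ t ≡ suc c) × (b ≡ t + suc c) × (t ⊓ b ≡ t)
beyondFirstBlock t b b≰t with b ∸ t in e
... | zero  = ⊥-elim (b≰t (m∸n≡0⇒m≤n e))
... | suc c = c , refl , trans (sym (m+[n∸m]≡n t≤b)) (cong (t +_) e) , m≤n⇒m⊓n≡m t≤b
  where
  t≤b : t ≤ b
  t≤b = ≤-trans (n≤1+n t) (≰⇒> b≰t)

-- Every letter 1 of the prefix is a pendant leaf, and the last spine vertex is a leaf exactly
-- when its block is cut right after its letter 0 (the first spine vertex has a predecessor here).
profileLeaves₁-prefix : ∀ t s b →
  profileLeaves 1 (prefixSpine (t ∷ s) (suc b)) (prefixPendants (t ∷ s) (suc b)) (suc (length s))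
  ≡ ones (take (suc b) (encode (t ∷ s))) + trailingZero (take (suc b) (encode (t ∷ s)))
profileLeaves₁-prefix t s b with b N.≤? t
... | yes b≤t rewrite m≤n⇒m∸n≡0 b≤t | m≥n⇒m⊓n≡n b≤t | prefixSpine-empty s 0 | take-replicate-true b t (encode s) b≤t
        | profileLeaves-empty (length s) 1 (prefixSpine s 0) (prefixPendants s 0) (prefixSpine-empty s) (prefixPendants-empty s)
        | trailingZero-block b | ones-replicate-true b = regroup (bit (b ≡ᵇ 0)) b
  where
  regroup : ∀ B b → (1 * B + b * 1) + 0 ≡ b + B
  regroup = solve-∀
... | no b≰t with beyondFirstBlock t b b≰t
...   | c , e₁ , e₂ , e₃ rewrite e₁ | e₂ | e₃ = laterBlocks s
  where
  regroup : ∀ B b → (1 * B + b * 1) + 0 ≡ b + B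
  regroup = solve-∀
  laterBlocks : ∀ s →
    (1 * bit ((1 + prefixSpine s (suc c) 0) + t ≡ᵇ 1) + t * bit (1 ≡ᵇ 1))
      + profileLeaves 1 (prefixSpine s (suc c)) (prefixPendants s (suc c)) (length s)
    ≡ ones (false ∷ take (t + suc c) (replicate t true ++ encode s))
      + trailingZero (false ∷ take (t + suc c) (replicate t true ++ encode s))
  laterBlocks [] rewrite take-replicate-true-++ t (suc c) [] | LP.++-identityʳ (replicate t true)
                       | trailingZero-block t | ones-replicate-true t = regroup (bit (t ≡ᵇ 0)) t
  laterBlocks (t′ ∷ s) =
    trans (cong ((1 * 0 + t * 1) +_) (profileLeaves₁-prefix t′ s c))
          (trans (regroup′ t _ _) (sym (onesTrailing-afterFirstBlock t c t′ s)))
    where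
    regroup′ : ∀ t O Z → (1 * 0 + t * 1) + (O + Z) ≡ (t + O) + Z
    regroup′ = solve-∀

profileLeaves-rootIndependent : ∀ pv pv′ xs cs k → 2 ≤ xs 1 + cs 0 →
  profileLeaves pv xs cs (suc k) ≡ profileLeaves pv′ xs cs (suc k)
profileLeaves-rootIndependent pv pv′ xs cs k deg≥2 =
  cong (λ z → (xs 0 * z + cs 0 * bit (xs 0 ≡ᵇ 1)) + profileLeaves (xs 0) (λ j → xs (suc j)) (λ j → cs (suc j)) k)
       (trans (notLeaf pv) (sym (notLeaf pv′)))
  where
  notLeaf : ∀ pv → bit ((pv + xs 1) + cs 0 ≡ᵇ 1) ≡ 0
  notLeaf pv = bit-≡ᵇ1 _ (≤-trans deg≥2 (≤-trans (m≤n+m _ pv) (≤-reflexive (sym (+-assoc pv (xs 1) (cs 0))))))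

-- The first spine vertex, having no predecessor, has degree at least 2 once the prefix has 3 letters.
profileLeaves-prefix : ∀ t s b → 1 ≤ t → 2 ≤ b → suc b ≤ length (encode (t ∷ s)) →
  profileLeaves 0 (prefixSpine (t ∷ s) (suc b)) (prefixPendants (t ∷ s) (suc b)) (suc (length s))
  ≡ ones (take (suc b) (encode (t ∷ s))) + trailingZero (take (suc b) (encode (t ∷ s)))
profileLeaves-prefix t s b t≥1 b≥2 b<len =
  trans (profileLeaves-rootIndependent 0 1 (prefixSpine (t ∷ s) (suc b)) (prefixPendants (t ∷ s) (suc b)) (length s) rootDegree)
        (profileLeaves₁-prefix t s b)
  where
  rootDegree : 2 ≤ prefixSpine s (b ∸ t) 0 + t ⊓ b
  rootDegree with b N.≤? t
  ... | yes b≤t = ≤-trans b≥2 (≤-trans (≤-reflexive (sym (m≥n⇒m⊓n≡n b≤t))) (m≤n+m _ _))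
  ... | no  b≰t with beyondFirstBlock t b b≰t
  ...   | c , e₁ , _ , e₃ rewrite e₁ | e₃ = nextPresent s b<len
    where
    nextPresent : ∀ s → suc b ≤ length (encode (t ∷ s)) → 2 ≤ prefixSpine s (suc c) 0 + t
    nextPresent []      b<len = ⊥-elim (b≰t (≤-pred (≤-trans b<len (≤-reflexive (trans (length-encode-∷ t []) (cong suc (+-identityʳ t)))))))
    nextPresent (_ ∷ _) _     = s≤s t≥1

-- Induced subgraphs of a caterpillar are acyclic

rank : Label → ℕ
rank (spine a) = a + a
rank (leaf a) = suc (a + a)

parentPosition : Label → ℕ
parentPosition (spine a) = N.pred a
parentPosition (leaf a) = a

1+n≡ᵇn : ∀ a → (suc a ≡ᵇ a) ≡ false
1+n≡ᵇn zero = refl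
1+n≡ᵇn (suc a) = 1+n≡ᵇn a

n+n-injective : ∀ a b → a + a ≡ b + b → a ≡ b
n+n-injective a b e = trans (n≡⌊n+n/2⌋ a) (trans (cong ⌊_/2⌋ e) (sym (n≡⌊n+n/2⌋ b)))

labelAdj-lowerRank : ∀ a b → T (labelAdj a b) → rank a < rank b → a ≡ spine (parentPosition b)
labelAdj-lowerRank (spine a) (spine b) t lt with suc a ≡ᵇ b in e
... | true rewrite sym (≡ᵇ⇒≡ (suc a) b (≡true⇒T e)) = refl
... | false rewrite sym (≡ᵇ⇒≡ (suc b) a t) = ⊥-elim (<-irrefl refl (<-trans lt (s≤s (≤-trans (n≤1+n _) (≤-reflexive (sym (+-suc b b)))))))
labelAdj-lowerRank (spine a) (leaf b) t lt rewrite ≡ᵇ⇒≡ a b t = refl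
labelAdj-lowerRank (leaf a) (spine b) t lt rewrite ≡ᵇ⇒≡ a b t = ⊥-elim (<-irrefl refl (<-trans (n<1+n (b + b)) lt))
labelAdj-lowerRank (leaf a) (leaf b) () lt

labelAdj⇒rank≢ : ∀ a b → T (labelAdj a b) → rank a ≢ rank b
labelAdj⇒rank≢ (spine a) (spine b) t e rewrite n+n-injective a b e | 1+n≡ᵇn b = t
labelAdj⇒rank≢ (spine a) (leaf b) t e rewrite ≡ᵇ⇒≡ a b t = 1+n≢n (sym e)
labelAdj⇒rank≢ (leaf a) (spine b) t e rewrite ≡ᵇ⇒≡ a b t = 1+n≢n e
labelAdj⇒rank≢ (leaf a) (leaf b) () e

labelAdj-sym : ∀ a b → T (labelAdj a b) → T (labelAdj b a)
labelAdj-sym (spine a) (spine b) t with suc a ≡ᵇ b | suc b ≡ᵇ a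
... | true | true = tt
... | true | false = tt
... | false | true = tt
labelAdj-sym (spine a) (leaf b) t rewrite ≡ᵇ-sym a b = t
labelAdj-sym (leaf a) (spine b) t rewrite ≡ᵇ-sym a b = t

count-lookup : ∀ xs (v : Fin (length xs)) → 1 ≤ count (L.lookup xs v) xs
count-lookup (a ∷ xs) F.zero = count-here a xs
count-lookup (a ∷ xs) (F.suc v) = count-there (L.lookup xs v) a xs (count-lookup xs v)

count≥2 : ∀ xs (u u′ : Fin (length xs)) → u ≢ u′ → ∀ ℓ → L.lookup xs u ≡ ℓ → L.lookup xs u′ ≡ ℓ → 2 ≤ count ℓ xs
count≥2 (a ∷ xs) F.zero F.zero ne ℓ e e′ = ⊥-elim (ne refl)
count≥2 (a ∷ xs) F.zero (F.suc u′) ne ℓ refl e′ rewrite sameLabel-refl a = s≤s (subst (λ z → 1 ≤ count z xs) e′ (count-lookup xs u′))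
count≥2 (a ∷ xs) (F.suc u) F.zero ne ℓ e refl rewrite sameLabel-refl a = s≤s (subst (λ z → 1 ≤ count z xs) e (count-lookup xs u))
count≥2 (a ∷ xs) (F.suc u) (F.suc u′) ne ℓ e e′ = ≤-trans (count≥2 xs u u′ (λ eq → ne (cong F.suc eq)) ℓ e e′) (m≤n+m _ _)

spine-unique : ∀ s (u u′ : Fin (length (labels s))) a → L.lookup (labels s) u ≡ spine a → L.lookup (labels s) u′ ≡ spine a → u ≡ u′
spine-unique s u u′ a e e′ with u F.≟ u′
... | yes eq = eq
... | no u≢u′ = ⊥-elim (m+1+n≰m 1 (≤-trans (count≥2 (labels s) u u′ u≢u′ (spine a) e e′) (count-spine-labels-≤1 s a)))

labelAdj-spine-suc : ∀ j → T (labelAdj (spine (suc j)) (spine j))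
labelAdj-spine-suc j rewrite 2+n≡ᵇn j = ≡⇒≡ᵇ j j refl

labelAdj-leaf-spine : ∀ j → T (labelAdj (leaf j) (spine j))
labelAdj-leaf-spine j = ≡⇒≡ᵇ j j refl

-- Every vertex has at most one neighbour of smaller rank, so a non-backtracking walk that
-- once goes up in rank keeps going up and can never close a cycle.
module Acyclicity (s : List ℕ) where
  labs = labels s
  V = Fin (length labs)
  lab : V → Label
  lab = L.lookup labs
  A : V → V → Set
  A u v = T (labelAdj (lab u) (lab v))
  ψ : V → ℕ
  ψ u = rank (lab u)

  lowerNeighbour-unique : ∀ u v v′ → A v u → A v′ u → ψ v < ψ u → ψ v′ < ψ u → v ≡ v′
  lowerNeighbour-unique u v v′ a a′ lt lt′ = spine-unique s v v′ _ (labelAdj-lowerRank (lab v) (lab u) a lt) (labelAdj-lowerRank (lab v′) (lab u) a′ lt′)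

  adjacent-rank : ∀ u v → A u v → (ψ u < ψ v) ⊎ (ψ v < ψ u)
  adjacent-rank u v a with <-cmp (ψ u) (ψ v)
  ... | tri< lt _ _ = inj₁ lt
  ... | tri≈ _ eq _ = ⊥-elim (labelAdj⇒rank≢ (lab u) (lab v) a eq)
  ... | tri> _ _ gt = inj₂ gt

  Walk : V → List V → Set
  Walk a [] = ⊤
  Walk a (b ∷ l) = A a b × Walk b l

  NonBacktracking : V → List V → Set
  NonBacktracking a [] = ⊤
  NonBacktracking a (b ∷ []) = ⊤
  NonBacktracking a (b ∷ c ∷ l) = (a ≢ c) × NonBacktracking b (c ∷ l)

  EndsAscending : V → List V → Set
  EndsAscending a [] = ⊥
  EndsAscending a (b ∷ []) = ψ a < ψ b
  EndsAscending a (b ∷ c ∷ l) = EndsAscending b (c ∷ l)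

  ascending : ∀ a b l → Walk a (b ∷ l) → NonBacktracking a (b ∷ l) → ψ a < ψ b → (ψ a < ψ (lastOr b l)) × EndsAscending a (b ∷ l)
  ascending a b [] w nb lt = lt , lt
  ascending a b (c ∷ l) (ab , bc , w) (ne , nb) lt with adjacent-rank b c bc
  ... | inj₂ down = ⊥-elim (ne (lowerNeighbour-unique b a c ab (labelAdj-sym (lab b) (lab c) bc) lt down))
  ... | inj₁ up with ascending b c l (bc , w) nb up
  ...   | lt′ , lu = <-trans lt lt′ , lu

  descending : ∀ a b l → Walk a (b ∷ l) → NonBacktracking a (b ∷ l) → ¬ EndsAscending a (b ∷ l) → ψ (lastOr b l) < ψ a
  descending a b [] (ab , _) nb nlu with adjacent-rank a b ab
  ... | inj₁ up = ⊥-elim (nlu up)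
  ... | inj₂ down = down
  descending a b (c ∷ l) (ab , w) (ne , nb) nlu with adjacent-rank a b ab
  ... | inj₁ up = ⊥-elim (nlu (proj₂ (ascending a b (c ∷ l) (ab , w) (ne , nb) up)))
  ... | inj₂ down = <-trans (descending b c l w nb nlu) down

  lastOr-∷ʳ : ∀ a (l : List V) z → lastOr a (l ++ [ z ]) ≡ z
  lastOr-∷ʳ a [] z = refl
  lastOr-∷ʳ a (b ∷ l) z = lastOr-∷ʳ b l z

  EndsAscending-∷ʳ : ∀ a l z → EndsAscending a (l ++ [ z ]) → ψ (lastOr a l) < ψ z
  EndsAscending-∷ʳ a [] z lu = lu
  EndsAscending-∷ʳ a (b ∷ []) z lu = lu
  EndsAscending-∷ʳ a (b ∷ c ∷ l) z lu = EndsAscending-∷ʳ b (c ∷ l) z lu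

  module _ (X : Subset (length labs)) where
    chainIn⇒walk : ∀ a l z → ChainIn (caterpillar s) X a l → AdjIn (caterpillar s) X (lastOr a l) z → Walk a (l ++ [ z ])
    chainIn⇒walk a [] z _ (_ , _ , adj) = adj , tt
    chainIn⇒walk a (b ∷ l) z ((_ , _ , ab) , ch) cl = ab , chainIn⇒walk b l z ch cl

  unique-∷ʳ : ∀ (x : V) xs → Unique (x ∷ xs) → Unique (xs ++ [ x ])
  unique-∷ʳ x [] _ = All.[] ∷ []
  unique-∷ʳ x (y ∷ ys) ((x≢y ∷ x≢ys) ∷ (y≢ys ∷ uys)) =
    AllP.∷ʳ⁺ y≢ys (x≢y ∘ sym) ∷ unique-∷ʳ x ys (x≢ys ∷ uys)

  unique⇒nonBacktracking : ∀ a l → Unique (a ∷ l) → NonBacktracking a l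
  unique⇒nonBacktracking a [] _ = tt
  unique⇒nonBacktracking a (b ∷ []) _ = tt
  unique⇒nonBacktracking a (b ∷ c ∷ l) ((_ ∷ a≢c ∷ _) ∷ u) = a≢c , unique⇒nonBacktracking b (c ∷ l) u

  All-lastOr : ∀ (y r : V) rs → All (λ z → y ≢ z) (r ∷ rs) → y ≢ lastOr r rs
  All-lastOr y r [] (p All.∷ _) = p
  All-lastOr y r (r′ ∷ rs) (_ All.∷ ps) = All-lastOr y r′ rs ps

  caterpillar-acyclic : ∀ X → Acyclic (caterpillar s) X
  caterpillar-acyclic X ([] , ())
  caterpillar-acyclic X (x ∷ [] , (s≤s () , _))
  caterpillar-acyclic X (x ∷ y₁ ∷ [] , (s≤s (s≤s ()) , _))
  caterpillar-acyclic X (x ∷ y₁ ∷ y₂ ∷ rest , (len , uq@((_ ∷ x≢y₂ ∷ _) ∷ (y₁≢rest ∷ _)) , ch , cl)) with adjacent-rank x y₁ (proj₂ (proj₂ (proj₁ ch)))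
  ... | inj₁ up = <-irrefl refl (subst (λ z → ψ x < ψ z) (lastOr-∷ʳ y₁ (y₂ ∷ rest) x) (proj₁ (ascending x y₁ (y₂ ∷ rest ++ [ x ]) w nb up)))
    where
    w : Walk x (y₁ ∷ y₂ ∷ rest ++ [ x ])
    w = chainIn⇒walk X x (y₁ ∷ y₂ ∷ rest) x ch cl
    nb : NonBacktracking x (y₁ ∷ y₂ ∷ rest ++ [ x ])
    nb = x≢y₂ , unique⇒nonBacktracking y₁ (y₂ ∷ rest ++ [ x ]) (unique-∷ʳ x (y₁ ∷ y₂ ∷ rest) uq)
  ... | inj₂ down with adjacent-rank (lastOr y₂ rest) x (proj₂ (proj₂ cl))
  ...   | inj₁ lastup = All-lastOr y₁ y₂ rest y₁≢rest (lowerNeighbour-unique x y₁ (lastOr y₂ rest) (labelAdj-sym (lab x) (lab y₁) (proj₂ (proj₂ (proj₁ ch)))) (proj₂ (proj₂ cl)) down lastup)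
  ...   | inj₂ lastdown = <-irrefl refl (subst (λ z → ψ z < ψ x) (lastOr-∷ʳ y₁ (y₂ ∷ rest) x) (descending x y₁ (y₂ ∷ rest ++ [ x ]) w nb nlu))
    where
    w : Walk x (y₁ ∷ y₂ ∷ rest ++ [ x ])
    w = chainIn⇒walk X x (y₁ ∷ y₂ ∷ rest) x ch cl
    nb : NonBacktracking x (y₁ ∷ y₂ ∷ rest ++ [ x ])
    nb = x≢y₂ , unique⇒nonBacktracking y₁ (y₂ ∷ rest ++ [ x ]) (unique-∷ʳ x (y₁ ∷ y₂ ∷ rest) uq)
    nlu : ¬ EndsAscending x (y₁ ∷ y₂ ∷ rest ++ [ x ])
    nlu lu = <-asym (EndsAscending-∷ʳ x (y₁ ∷ y₂ ∷ rest) x lu) lastdown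



module UpperBound (s : List ℕ) (X : Subset (length (labels s))) (conn : Connected (caterpillar s) X) where
  private
    labs = labels s
    M    = selected labs X
    xs   = spineProfile M
    cs   = pendantProfile M

  count-≤ : ∀ ℓ → count ℓ M ≤ count ℓ labs
  count-≤ ℓ = sumOver-selected-≤ labs X (λ a → bit (sameLabel ℓ a))

  bounded : ∀ ℓ → 1 ≤ count ℓ M → position ℓ < length s
  bounded ℓ c = position-labels s ℓ (≤-trans c (count-≤ ℓ))

  -- A pendant leaf without its spine vertex is, by connectedness, all there is.
  strayPendant⇒noLeaves : ∀ j → 1 ≤ cs j → xs j ≡ 0 → leaves M ≡ 0
  strayPendant⇒noLeaves j cj xj = sumOver-zero M (λ ℓ c → cong (λ z → bit (z ≡ᵇ 1)) (degree-zero ℓ c))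
    where
    onlyLeaf : ∀ ℓ → 1 ≤ count ℓ M → ℓ ≡ leaf j
    onlyLeaf ℓ c = connected-closed s X conn (_≡ leaf j) closed (leaf j) ℓ cj c refl
      where
      closed : ∀ a b → 1 ≤ count a M → 1 ≤ count b M → T (labelAdj a b) → a ≡ leaf j → b ≡ leaf j
      closed _ (spine b) _ cb t refl rewrite sym (≡ᵇ⇒≡ j b t) = ⊥-elim (n≮0 (subst (1 ≤_) xj cb))
    degree-zero : ∀ ℓ → 1 ≤ count ℓ M → degree M ℓ ≡ 0
    degree-zero ℓ c rewrite onlyLeaf ℓ c =
      sumOver-zero M (λ a ca → cong (λ z → bit (labelAdj z (leaf j))) (onlyLeaf a ca))

  NoStrayPendant : Set
  NoStrayPendant = ∀ j → j < length s → ¬ ((1 ≤ cs j) × (xs j ≡ 0))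

  profile : NoStrayPendant → Profile s xs cs
  profile noStray = record
    { spine≤1       = λ j → ≤-trans (count-≤ (spine j)) (count-spine-labels-≤1 s j)
    ; pendants≤     = λ j → ≤-trans (count-≤ (leaf j)) (≤-reflexive (count-leaf-labels s j))
    ; spine-beyond  = λ j k≤j → n≤0⇒n≡0 (≤-trans (count-≤ (spine j)) (≤-reflexive (count-spine-labels-beyond s j k≤j)))
    ; spine-convex  = convex
    ; pendant⇒spine = λ j c → n≢0⇒n>0 (λ xj → noStray j (bounded (leaf j) c) (c , xj))
    }
    where
    convex : ∀ a j b → a < j → j < b → 1 ≤ xs a → 1 ≤ xs b → 1 ≤ xs j
    convex a j b a<j j<b xa xb with 1 ≤? xs j
    ... | yes xj  = xj
    ... | no  ¬xj = ⊥-elim (<-asym j<b b<j)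
      where
      -- with spine vertex j missing, nothing to the right of j is reachable from the left
      closed : ∀ a′ b′ → 1 ≤ count a′ M → 1 ≤ count b′ M → T (labelAdj a′ b′) → position a′ < j → position b′ < j
      closed (spine a′) (spine b′) _ cb t a′<j with suc a′ ≡ᵇ b′ in e
      ... | true rewrite sym (≡ᵇ⇒≡ (suc a′) b′ (≡true⇒T e)) with m≤n⇒m<n∨m≡n a′<j
      ...   | inj₁ b′<j = b′<j
      ...   | inj₂ refl = ⊥-elim (¬xj cb)
      closed (spine a′) (spine b′) _ _ t a′<j | false rewrite sym (≡ᵇ⇒≡ (suc b′) a′ t) = <-trans (n<1+n b′) a′<j
      closed (spine a′) (leaf b′)  _ _ t a′<j rewrite sym (≡ᵇ⇒≡ a′ b′ t) = a′<j
      closed (leaf a′)  (spine b′) _ _ t a′<j rewrite sym (≡ᵇ⇒≡ a′ b′ t) = a′<j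
      b<j : b < j
      b<j = connected-closed s X conn (λ ℓ → position ℓ < j) closed (spine a) (spine b) xa xb a<j

  leavesIn-bound : HeadPositive s → ∀ i → ∣ X ∣ ≡ i → 3 ≤ i →
    (leavesIn (caterpillar s) X ≡ 0) ⊎ BoundedByFactor s i (leavesIn (caterpillar s) X)
  leavesIn-bound hp i card i≥3 with anyUpTo? (λ j → (1 ≤? cs j) ×-dec (xs j N.≟ 0)) (length s)
  ... | yes (j , _ , cj , xj) = inj₁ (trans (leavesIn≡leaves s X) (strayPendant⇒noLeaves j cj xj))
  ... | no  noStray = inj₂ (subst (BoundedByFactor s i) (sym leaves≡)
                              (factorBound′ s hp (profile (λ j j<k p → noStray (j , j<k , p))) size≡i))
    where
    leaves≡ : leavesIn (caterpillar s) X ≡ profileLeaves 0 xs cs (length s)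
    leaves≡ = trans (leavesIn≡leaves s X) (leaves≡profileLeaves M (length s) bounded)
    size≡i : profileSize xs cs (length s) ≡ i
    size≡i = trans (sym (length≡profileSize M (length s) bounded)) (trans (sym (∣∣≡length-selected labs X)) card)
    factorBound′ : ∀ s → HeadPositive s → Profile s xs cs → profileSize xs cs (length s) ≡ i →
                   BoundedByFactor s i (profileLeaves 0 xs cs (length s))
    factorBound′ (suc t ∷ s) _ P size≡i = factorBound t s xs cs P i size≡i i≥3

-- An induced tree realising the bound

module LowerBound (s : List ℕ) (hp : HeadPositive s) (L : ℕ) (fits : 3 + L ≤ length (encode s)) where
  private
    labs = labels s
    G    = caterpillar s
    k    = length s
    i    = 3 + L

  demand : Label → ℕ
  demand (spine j) = prefixSpine s i j
  demand (leaf j)  = prefixPendants s i j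

  X : Subset (length labs)
  X = realize labs demand

  private
    M = selected labs X

  demand-≤ : ∀ ℓ → demand ℓ ≤ count ℓ labs
  demand-≤ (spine j) with ≤1⇒≡0⊎≡1 (prefixSpine≤1 s i j)
  ... | inj₁ e = ≤-trans (≤-reflexive e) z≤n
  ... | inj₂ e = ≤-trans (≤-reflexive e)
                         (≤-reflexive (sym (count-spine-labels s j (prefixSpine⇒<length s i j (≤-reflexive (sym e))))))
  demand-≤ (leaf j) = ≤-trans (prefixPendants≤ s i j) (≤-reflexive (sym (count-leaf-labels s j)))

  count-M : ∀ ℓ → count ℓ M ≡ demand ℓ
  count-M ℓ = trans (count-realize labs demand ℓ) (m≤n⇒m⊓n≡m (demand-≤ ℓ))

  bounded : ∀ ℓ → 1 ≤ count ℓ M → position ℓ < k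
  bounded ℓ c = position-labels s ℓ (≤-trans c (sumOver-selected-≤ labs X (λ a → bit (sameLabel ℓ a))))

  card : ∣ X ∣ ≡ i
  card = begin
    ∣ X ∣                                 ≡⟨ ∣∣≡length-selected labs X ⟩
    length M                              ≡⟨ length≡profileSize M k bounded ⟩
    profileSize (spineProfile M) (pendantProfile M) k
      ≡⟨ sumUpTo-cong k (λ j → cong₂ _+_ (count-M (spine j)) (count-M (leaf j))) ⟩
    profileSize (prefixSpine s i) (prefixPendants s i) k ≡⟨ profileSize-prefix s i fits ⟩
    i                                     ∎
    where open ≡-Reasoning

  leavesIn-X : leavesIn G X ≡ ones (take i (encode s)) + trailingZero (take i (encode s))
  leavesIn-X = begin
    leavesIn G X                                    ≡⟨ leavesIn≡leaves s X ⟩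
    leaves M                                        ≡⟨ leaves≡profileLeaves M k bounded ⟩
    profileLeaves 0 (spineProfile M) (pendantProfile M) k
      ≡⟨ profileLeaves-cong k refl (λ j → count-M (spine j)) (λ j → count-M (leaf j)) ⟩
    profileLeaves 0 (prefixSpine s i) (prefixPendants s i) k ≡⟨ prefixLeaves s hp fits ⟩
    ones (take i (encode s)) + trailingZero (take i (encode s)) ∎
    where
    open ≡-Reasoning
    prefixLeaves : ∀ s → HeadPositive s → i ≤ length (encode s) →
      profileLeaves 0 (prefixSpine s i) (prefixPendants s i) (length s) ≡ ones (take i (encode s)) + trailingZero (take i (encode s))
    prefixLeaves (t ∷ s) t≥1 = profileLeaves-prefix t s (2 + L) t≥1 (s≤s (s≤s z≤n))

  present : ∀ ℓ → 1 ≤ demand ℓ → VertexOf labs X ℓ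
  present ℓ h = count-selected⇒vertex labs X ℓ (≤-trans h (≤-reflexive (sym (count-M ℓ))))

  demanded : ∀ u → T (lookup X u) → 1 ≤ demand (L.lookup labs u)
  demanded u tu = ≤-trans (count-selected-lookup labs X u tu) (≤-reflexive (count-M (L.lookup labs u)))

  root : VertexOf labs X (spine 0)
  root = present (spine 0) (firstSpine s hp)
    where
    firstSpine : ∀ s → HeadPositive s → 1 ≤ prefixSpine s i 0
    firstSpine (t ∷ _) _ = ≤-refl

  private
    r = proj₁ root

  edge : ∀ {u v a b} → T (lookup X u) → T (lookup X v) → L.lookup labs u ≡ a → L.lookup labs v ≡ b →
         T (labelAdj a b) → AdjIn G X u v
  edge tu tv refl refl t = tu , tv , t

  spine-reaches-root : ∀ j u → T (lookup X u) → L.lookup labs u ≡ spine j → Star (AdjIn G X) u r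
  spine-reaches-root zero    u tu e = subst (λ z → Star (AdjIn G X) z r) (spine-unique s r u 0 (proj₂ (proj₂ root)) e) ε
  spine-reaches-root (suc j) u tu e with present (spine j) (prefixSpine-pred s i j (subst (λ ℓ → 1 ≤ demand ℓ) e (demanded u tu)))
  ... | u′ , tu′ , e′ = edge tu tu′ e e′ (labelAdj-spine-suc j) ◅ spine-reaches-root j u′ tu′ e′

  reaches-root : ∀ u → T (lookup X u) → Star (AdjIn G X) u r
  reaches-root u tu with L.lookup labs u in e
  ... | spine j = spine-reaches-root j u tu e
  ... | leaf j with present (spine j) (prefixPendants⇒prefixSpine s i j (subst (λ ℓ → 1 ≤ demand ℓ) e (demanded u tu)))
  ...   | u′ , tu′ , e′ = edge tu tu′ e e′ (labelAdj-leaf-spine j) ◅ spine-reaches-root j u′ tu′ e′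

  connected : Connected G X
  connected u v tu tv = reaches-root u tu ◅◅ Star.reverse symmetric (reaches-root v tv)
    where
    symmetric : ∀ {u v} → AdjIn G X u v → AdjIn G X v u
    symmetric {u} {v} (iu , iv , t) = iv , iu , labelAdj-sym (L.lookup labs u) (L.lookup labs v) t

  tree : InducedTree G X
  tree = (r , proj₁ (proj₂ root)) , connected , Acyclicity.caterpillar-acyclic s X

take-++-≤ : ∀ n (u v : Word) → n ≤ length u → take n (u ++ v) ≡ take n u
take-++-≤ zero    u       v _         = refl
take-++-≤ (suc n) (a ∷ u) v (s≤s n≤u) = cong (a ∷_) (take-++-≤ n u v n≤u)

take-drop-++ : ∀ p n (u v : Word) → p + n ≤ length u → take n (drop p (u ++ v)) ≡ take n (drop p u)
take-drop-++ zero    n u       v fits       = take-++-≤ n u v fits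
take-drop-++ (suc p) n (a ∷ u) v (s≤s fits) = take-drop-++ p n u v fits

ones+trailingZero-take-suc : ∀ n (W : Word) → suc n ≤ length W →
  ones (take (suc n) W) + trailingZero (take (suc n) W) ≡ suc (ones (take n W))
ones+trailingZero-take-suc zero    (true ∷ W)     _ = refl
ones+trailingZero-take-suc zero    (false ∷ W)    _ = refl
ones+trailingZero-take-suc (suc n) (a ∷ a′ ∷ W) (s≤s n<W) = begin
  (bit a + ones (take (suc n) (a′ ∷ W))) + trailingZero (take (suc n) (a′ ∷ W))
    ≡⟨ +-assoc (bit a) _ _ ⟩
  bit a + (ones (take (suc n) (a′ ∷ W)) + trailingZero (take (suc n) (a′ ∷ W)))
    ≡⟨ cong (bit a +_) (ones+trailingZero-take-suc n (a′ ∷ W) n<W) ⟩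
  bit a + suc (ones (take n (a′ ∷ W)))
    ≡⟨ +-suc (bit a) _ ⟩
  suc (bit a + ones (take n (a′ ∷ W))) ∎
  where open ≡-Reasoning

onesTrailing-RC : ∀ w L → L ≤ length w →
  ones (take (3 + L) (encode (RC w))) + trailingZero (take (3 + L) (encode (RC w))) ≡ 2 + ones (take L w)
onesTrailing-RC w L L≤w rewrite encode-RC w =
  trans (skipFalseTrue (take (suc L) (w ∷ʳ true)) (nonEmpty w))
        (cong suc (trans (ones+trailingZero-take-suc L (w ∷ʳ true) L<w1)
                         (cong (suc ∘ ones) (take-++-≤ L w [ true ] L≤w))))
  where
  L<w1 : suc L ≤ length (w ∷ʳ true)
  L<w1 = ≤-trans (s≤s L≤w) (≤-reflexive (trans (+-comm 1 (length w)) (sym (LP.length-++ w))))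
  nonEmpty : ∀ (w : Word) → take (suc L) (w ∷ʳ true) ≢ []
  nonEmpty []      ()
  nonEmpty (_ ∷ _) ()
  skipFalseTrue : ∀ Q → Q ≢ [] → ones (false ∷ true ∷ Q) + trailingZero (false ∷ true ∷ Q) ≡ suc (ones Q + trailingZero Q)
  skipFalseTrue []      Q≢[] = ⊥-elim (Q≢[] refl)
  skipFalseTrue (q ∷ Q) _    = refl

leavesIn-RC-≤ : ∀ w → PrefixNormal w → ∀ L X → ∣ X ∣ ≡ 3 + L → InducedTree (caterpillar (RC w)) X →
                leavesIn (caterpillar (RC w)) X ≤ 2 + ones (take L w)
leavesIn-RC-≤ w pn L X card (_ , conn , _)
  with UpperBound.leavesIn-bound (RC w) X conn (headPositive-RC w) (3 + L) card (s≤s (s≤s (s≤s z≤n)))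
... | inj₁ noLeaves = ≤-trans (≤-reflexive noLeaves) z≤n
... | inj₂ (p , fits , bound) =
  ≤-trans bound (+-monoʳ-≤ 2 (≤-trans (≤-reflexive (cong ones factor)) (pn p L p+L≤w)))
  where
  p+L≤w : p + L ≤ length w
  p+L≤w = +-cancelʳ-≤ 3 (p + L) (length w)
            (≤-trans (≤-reflexive (trans (+-assoc p L 3) (cong (p +_) (+-comm L 3))))
                     (≤-trans fits (≤-reflexive (length-encode-RC w))))
  factor : take L (drop p (innerWord (RC w))) ≡ take L (drop p w)
  factor = trans (cong (λ z → take L (drop p z)) (innerWord-RC w)) (take-drop-++ p L w [ true ] p+L≤w)

leafValue-RC : ∀ w → PrefixNormal w → ∀ L → L ≤ length w →
               LeafValue (caterpillar (RC w)) (L + 3) (fin (2 + ones (take L w)))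
leafValue-RC w pn L L≤w = subst (λ i → LeafValue (caterpillar (RC w)) i (fin (2 + ones (take L w)))) (+-comm 3 L)
  ((X , card , tree , trans leavesIn-X (onesTrailing-RC w L L≤w)) , λ S ∣S∣ S-tree → leavesIn-RC-≤ w pn L S ∣S∣ S-tree)
  where
  fits : 3 + L ≤ length (encode (RC w))
  fits = ≤-trans (≤-reflexive (+-comm 3 L)) (≤-trans (+-monoˡ-≤ 3 L≤w) (≤-reflexive (sym (length-encode-RC w))))
  open LowerBound (RC w) (headPositive-RC w) L fits

ones-take-suc : ∀ (w : Word) (j : Fin (length w)) → ones (take (suc (toℕ j)) w) ≡ ones (take (toℕ j) w) + bit (L.lookup w j)
ones-take-suc (a ∷ w) F.zero    = +-comm (bit a) 0
ones-take-suc (a ∷ w) (F.suc j) = trans (cong (bit a +_) (ones-take-suc w j)) (sym (+-assoc (bit a) _ _))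

leafIncrement : ∀ (w : Word) (j : Fin (length w)) →
  (2 + ones (take (suc (toℕ j)) w)) ⊖ (2 + ones (take (toℕ j) w)) ≡ Z.+ bit (L.lookup w j)
leafIncrement w j = begin
  (2 + ones (take (suc (toℕ j)) w)) ⊖ (2 + ones (take (toℕ j) w))  ≡⟨ cong (λ z → (2 + z) ⊖ a) (ones-take-suc w j) ⟩
  (a + bit (L.lookup w j)) ⊖ a                                      ≡⟨ ZP.≤-⊖ (m≤m+n a _) ⟩
  Z.+ ((a + bit (L.lookup w j)) ∸ a)                                ≡⟨ cong Z.+_ (m+n∸m≡n a _) ⟩
  Z.+ bit (L.lookup w j)                                            ∎
  where
  open ≡-Reasoning
  a = 2 + ones (take (toℕ j) w)

proposition3 : ∀ (w : Word) → PrefixNormal w →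
    (∀ (i : ℕ) → 3 ≤ i → i ≤ length w + 3 →
       LeafValue (caterpillar (RC w)) i (fin (leafCount (Left i (RC w)))))
    × LeafWordIs (caterpillar (RC w)) w
proposition3 w pn = leafFunction , leafWord
  where
  G = caterpillar (RC w)
  leafFunction : ∀ i → 3 ≤ i → i ≤ length w + 3 → LeafValue G i (fin (leafCount (Left i (RC w))))
  leafFunction (suc (suc (suc L))) (s≤s (s≤s (s≤s z≤n))) i≤ =
    subst₂ (λ i n → LeafValue G i (fin n)) (+-comm L 3) (sym (leafCount-Left-RC w L))
           (leafValue-RC w pn L (+-cancelʳ-≤ 3 L (length w) (≤-trans (≤-reflexive (+-comm L 3)) i≤)))
  leafWord : LeafWordIs G w
  leafWord = sym (trans (length-labels (RC w)) (size-RC w)) , λ j →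
    _ , _ , leafValue-RC w pn (toℕ j) (<⇒≤ (FP.toℕ<n j))
          , subst (λ i → LeafValue G i (fin (2 + ones (take (suc (toℕ j)) w)))) (sym (+-suc (toℕ j) 3)) (leafValue-RC w pn (suc (toℕ j)) (FP.toℕ<n j))
          , leafIncrement w j
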